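{- Let $D\in\mathrm{BPD}(\pi)$ with $\pi\ne\mathrm{id}$, and let $y_l$ be a biletter with $l\le d_1(\pi)$. Then during the right insertion of $y_l$ into $D$, every min-droop is performed on a pipe $p$ that does not occupy the horizontal (W–E) segment of any cross tile. In particular, every min-droop performed, from $(a,b)$ to $(a+x,b+y)$, is bounded by a rectangle of width $2$, i.e. $y=1$.
   Context: Permutations are in one-line notation; a descent of $\pi$ is an $i$ with $\pi(i)>\pi(i+1)$, and $d_1(\pi)$ is the first (smallest) descent position. Bumpless pipe dreams. Cells $(i,j)$ of the $n\times n$ grid (row $i$ from the top, column $j$ from the left) carry tiles recording which cell edges are joined by pipe segments: blank (none), horizontal (W–E), vertical (S–N), cross (W–E and S–N, two pipes), r-elbow (S–E), j-elbow (W–N), and, in intermediate stages only, bump (a W–N elbow and an S–E elbow carried by two different pipes). A bumpless pipe dream (BPD) of $\pi\in S_n$ is a tiling by the first six tiles whose segments form pipes such that for each $c$ the pipe $c$ enters at the bottom of column $c$, moves only north and east, and exits at the right end of row $\pi^{ -1}(c)$ ("pipe $c$ exits from row $\pi^{ -1}(c)$"), any two pipes crossing at most once; $\mathrm{BPD}(\pi)$ is the set of these. During the algorithm one cell may be a bump; pipes, exits and crossings are traced the same way. A pipe has an r-turn at a cell where it enters from the south and leaves east (r-elbow or SE part of a bump). Moves. min-droop at $(a,b)$, where pipe $p$ has an r-turn: let $x>0$ be smallest with $(a+x,b)$ not a cross and $y>0$ smallest with $(a,b+y)$ not a cross. Within the rectangle with corners $(a,b)$ and $(a+x,b+y)$,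 $p$ runs up the left column from $(a+x,b)$ to $(a,b)$ and then along the top row to $(a,b+y)$; replace this by the route along the bottom row from $(a+x,b)$ to $(a+x,b+y)$ and up the right column to $(a,b+y)$, other pipes unchanged, tiles redetermined by the segments (so $p$ gets a W–N turn at $(a+x,b+y)$, which becomes a j-elbow if it was blank and a bump if it was an r-elbow). Set $\operatorname{min-droop}(a,b)=(a+x,b+y)$. cross-bump-swap at a bump $(a,b)$ whose two pipes also cross at $(a',b')$: $(a,b)$ becomes a cross and $(a',b')$ a bump; $\operatorname{cross-bump-swap}(a,b)=(a',b')$. A biletter $b_k$ is a pair of positive integers with $b\le k$. Right insertion $D\leftarrow b_k$: let $(i,j)$ be the r-elbow in row $b$ with $j$ maximal. (1) min-droop at $(i,j)$; $(i_1,j_1)=\operatorname{min-droop}(i,j)$. (2) If $(i_1,j_1)$ is a j-elbow, let $(i_1,j_2)$ be the r-elbow in row $i_1$ with $j_2<j_1$ maximal, set $(i,j)=(i_1,j_2)$, go to (1). (3) If it is a bump: (a) if its two pipes cross somewhere, perform cross-bump-swap, set $(i,j)=\operatorname{cross-bump-swap}(i_1,j_1)$, go to (1); (b) otherwise let $p$ be the pipe with the r-turn there; if $p$ exits from a row $r\le k$, set $(i,j)=(i_1,j_1)$ and go to (1); otherwise replace the bump by a cross and stop. -}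

module Defs where

open import Data.Nat using (ℕ; zero; suc; _+_; _∸_; _<_; _≤_; _≡ᵇ_; _<ᵇ_; _<?_)
open import Data.Bool using (Bool; true; false; if_then_else_; _∧_)
open import Data.Fin using (Fin; toℕ)
open import Data.Fin.Permutation using (Permutation′; _⟨$⟩ʳ_; _⟨$⟩ˡ_)
open import Data.Maybe using (Maybe; just; nothing)
open import Data.List using (List; []; _∷_)
open import Data.List.Membership.Propositional using (_∈_)
open import Data.Product using (Σ; Σ-syntax; ∃; ∃-syntax; _×_; _,_)
open import Data.Sum using (_⊎_)
open import Data.Empty using (⊥)
open import Relation.Nullary using (¬_; yes; no)
open import Relation.Binary.PropositionalEquality using (_≡_; _≢_)

-- Conventions: rows and columns are 0-indexed naturals (row 0 is the top
-- row, column 0 the leftmost column).  A grid of size N uses the cells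
-- (i , j) with i < N and j < N; values outside are irrelevant.

data Tile : Set where
  blank hor ver cross rel jel bump : Tile
  -- hor = W–E, ver = S–N, rel = r-elbow (S–E), jel = j-elbow (W–N),
  -- bump = W–N elbow + S–E elbow (two different pipes)

Grid : Set
Grid = ℕ → ℕ → Tile

hasN hasS hasE hasW : Tile → Bool
hasN ver = true
hasN cross = true
hasN jel = true
hasN bump = true
hasN _ = false
hasS ver = true
hasS cross = true
hasS rel = true
hasS bump = true
hasS _ = false
hasE hor = true
hasE cross = true
hasE rel = true
hasE bump = true
hasE _ = false
hasW hor = true
hasW cross = true
hasW jel = true
hasW bump = true
hasW _ = false

data In : Set where
  fromS fromW : In

data Out : Set where
  toN toE : Out

route : Tile → In → Maybe Out
route ver fromS = just toN
route cross fromS = just toN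
route rel fromS = just toE
route bump fromS = just toE
route hor fromW = just toE
route cross fromW = just toE
route jel fromW = just toN
route bump fromW = just toN
route _ _ = nothing

Cell : Set
Cell = ℕ × ℕ × In

private
  consP : Cell → Maybe (List Cell × ℕ) → Maybe (List Cell × ℕ)
  consP c (just (ps , r)) = just (c ∷ ps , r)
  consP c nothing = nothing

-- trace a pipe in an N×N grid, from cell (i , j) entered from side d;
-- result: the visited cells (with entry sides) and the row it exits from
-- at the right boundary.
trace : ℕ → (N : ℕ) → Grid → ℕ → ℕ → In → Maybe (List Cell × ℕ)
trace zero N G i j d = nothing
trace (suc f) N G i j d with route (G i j) d
... | nothing = nothing
... | just toN with i
...   | zero = nothing
...   | suc i′ = consP (i , j , d) (trace f N G i′ j fromS)
trace (suc f) N G i j d | just toE with suc j <? N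
...   | yes _ = consP (i , j , d) (trace f N G i (suc j) fromW)
...   | no _ = just ((i , j , d) ∷ [] , i)

-- pipe c enters at the bottom of column c (fuel 2N suffices: moves N/E only)
pipe : (N : ℕ) → Grid → ℕ → Maybe (List Cell × ℕ)
pipe N G c = trace (N + N) N G (N ∸ 1) c fromS

Visits : (N : ℕ) → Grid → ℕ → Cell → Set
Visits N G c x = c < N × ∃[ ps ] ∃[ r ] (pipe N G c ≡ just (ps , r) × x ∈ ps)

VisitsCell : (N : ℕ) → Grid → ℕ → ℕ → ℕ → Set
VisitsCell N G c i j = ∃[ d ] Visits N G c (i , j , d)

ExitsRow : (N : ℕ) → Grid → ℕ → ℕ → Set
ExitsRow N G c r = c < N × ∃[ ps ] (pipe N G c ≡ just (ps , r))

-- π(i) = π ⟨$⟩ʳ i ,  π⁻¹(c) = π ⟨$⟩ˡ c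
IsBPD : (n : ℕ) → Permutation′ n → Grid → Set
IsBPD n π D =
  (∀ i j → i < n → j < n → D i j ≢ bump) ×
  (∀ i j → i < n → suc j < n → hasE (D i j) ≡ hasW (D i (suc j))) ×
  (∀ i j → suc i < n → j < n → hasN (D (suc i) j) ≡ hasS (D i j)) ×
  (∀ i → i < n → hasW (D i 0) ≡ false) ×
  (∀ j → j < n → hasN (D 0 j) ≡ false) ×
  (∀ j → j < n → hasS (D (n ∸ 1) j) ≡ true) ×
  (∀ i → i < n → hasE (D i (n ∸ 1)) ≡ true) ×
  (∀ (c : Fin n) → ExitsRow n D (toℕ c) (toℕ (π ⟨$⟩ˡ c))) ×
  (∀ c c′ → c ≢ c′ → ∀ i j i′ j′ → D i j ≡ cross → D i′ j′ ≡ cross →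
     VisitsCell n D c i j → VisitsCell n D c′ i j →
     VisitsCell n D c i′ j′ → VisitsCell n D c′ i′ j′ →
     (i ≡ i′ × j ≡ j′))

-- the standard embedding of a BPD of π ∈ S_n into a larger grid
-- (π viewed in S_N, fixing every value ≥ n)
embed : ℕ → Grid → Grid
embed n D i j =
  if (i <ᵇ n) ∧ (j <ᵇ n) then D i j
  else (if i ≡ᵇ j then rel else (if i <ᵇ j then hor else ver))

-- d is a descent: π(d) > π(d+1) (1-indexed positions d, d+1)
Descent : {n : ℕ} → Permutation′ n → ℕ → Set
Descent {n} π d = Σ[ i ∈ Fin n ] Σ[ j ∈ Fin n ]
  (suc (toℕ i) ≡ d × toℕ j ≡ d × toℕ (π ⟨$⟩ʳ j) < toℕ (π ⟨$⟩ʳ i))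

FirstDescent : {n : ℕ} → Permutation′ n → ℕ → Set
FirstDescent π d = Descent π d × (∀ e → e < d → ¬ Descent π e)

-- tile updates (nothing = the resulting segments form no valid tile)
removeSE turnNE dropV dropH addH addWN addV turnWS : Tile → Maybe Tile
removeSE rel = just blank
removeSE bump = just jel
removeSE _ = nothing
turnNE ver = just rel
turnNE jel = just hor
turnNE _ = nothing
dropV cross = just hor
dropV _ = nothing
dropH cross = just ver
dropH _ = nothing
addH ver = just cross
addH blank = just hor
addH _ = nothing
addWN blank = just jel
addWN rel = just bump
addWN _ = nothing
addV hor = just cross
addV blank = just ver
addV _ = nothing
turnWS jel = just ver
turnWS hor = just rel
turnWS _ = nothing

-- new tile at (i , j) after moving pipe p from the route
-- (a+x,b) ↑ (a,b) → (a,b+y)  to the route  (a+x,b) → (a+x,b+y) ↑ (a,b+y)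
droopTile : Grid → ℕ → ℕ → ℕ → ℕ → ℕ → ℕ → Maybe Tile
droopTile G a b x y i j =
  if (i ≡ᵇ a) ∧ (j ≡ᵇ b) then removeSE (G i j)
  else if (i ≡ᵇ a + x) ∧ (j ≡ᵇ b) then turnNE (G i j)
  else if (j ≡ᵇ b) ∧ (a <ᵇ i) ∧ (i <ᵇ a + x) then dropV (G i j)
  else if (i ≡ᵇ a) ∧ (b <ᵇ j) ∧ (j <ᵇ b + y) then dropH (G i j)
  else if (i ≡ᵇ a + x) ∧ (b <ᵇ j) ∧ (j <ᵇ b + y) then addH (G i j)
  else if (i ≡ᵇ a + x) ∧ (j ≡ᵇ b + y) then addWN (G i j)
  else if (j ≡ᵇ b + y) ∧ (a <ᵇ i) ∧ (i <ᵇ a + x) then addV (G i j)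
  else if (i ≡ᵇ a) ∧ (j ≡ᵇ b + y) then turnWS (G i j)
  else just (G i j)

-- MinDroop N G a b x y G′ : the min-droop at (a , b) in the N×N grid G is
-- performed, with parameters x, y, and produces G′;
-- min-droop(a , b) = (a + x , b + y).
MinDroop : (N : ℕ) → Grid → ℕ → ℕ → ℕ → ℕ → Grid → Set
MinDroop N G a b x y G′ =
  (G a b ≡ rel ⊎ G a b ≡ bump) ×
  (0 < x × a + x < N × (∀ t → 0 < t → t < x → G (a + t) b ≡ cross) × G (a + x) b ≢ cross) ×
  (0 < y × b + y < N × (∀ t → 0 < t → t < y → G a (b + t) ≡ cross) × G a (b + y) ≢ cross) ×
  (∀ i j → droopTile G a b x y i j ≡ just (G′ i j))

swapCB : Grid → ℕ → ℕ → ℕ → ℕ → Grid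
swapCB G i₁ j₁ a′ b′ i j =
  if (i ≡ᵇ i₁) ∧ (j ≡ᵇ j₁) then cross
  else if (i ≡ᵇ a′) ∧ (j ≡ᵇ b′) then bump
  else G i j

-- Right insertion, as the set of configurations "a min-droop is about to
-- be performed at (a , b) in grid G" reachable during the insertion.
-- Parameters: grid size N, initial grid G₀, start row r₀ (0-indexed, i.e.
-- b − 1 for the biletter b_k) and k.

data Reach (N : ℕ) (G₀ : Grid) (r₀ k : ℕ) : Grid → ℕ → ℕ → Set where
  start : ∀ {j} → r₀ < N → j < N → G₀ r₀ j ≡ rel →
          (∀ j′ → j < j′ → j′ < N → G₀ r₀ j′ ≢ rel) →
          Reach N G₀ r₀ k G₀ r₀ j
  stepJ : ∀ {G a b x y G′ j₂} → Reach N G₀ r₀ k G a b → MinDroop N G a b x y G′ →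
          G′ (a + x) (b + y) ≡ jel →
          j₂ < b + y → G′ (a + x) j₂ ≡ rel →
          (∀ j → j₂ < j → j < b + y → G′ (a + x) j ≢ rel) →
          Reach N G₀ r₀ k G′ (a + x) j₂
  stepSwap : ∀ {G a b x y G′ c₁ c₂ a′ b′} → Reach N G₀ r₀ k G a b → MinDroop N G a b x y G′ →
          G′ (a + x) (b + y) ≡ bump →
          Visits N G′ c₁ (a + x , b + y , fromW) → Visits N G′ c₂ (a + x , b + y , fromS) →
          G′ a′ b′ ≡ cross → VisitsCell N G′ c₁ a′ b′ → VisitsCell N G′ c₂ a′ b′ →
          Reach N G₀ r₀ k (swapCB G′ (a + x) (b + y) a′ b′) a′ b′
  -- step (3b): bump whose pipes do not cross, r-turn pipe exits row r ≤ k (1-indexed)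
  stepBump : ∀ {G a b x y G′ c r} → Reach N G₀ r₀ k G a b → MinDroop N G a b x y G′ →
          G′ (a + x) (b + y) ≡ bump →
          (∀ c₁ c₂ a′ b′ → Visits N G′ c₁ (a + x , b + y , fromW) →
             Visits N G′ c₂ (a + x , b + y , fromS) → G′ a′ b′ ≡ cross →
             VisitsCell N G′ c₁ a′ b′ → VisitsCell N G′ c₂ a′ b′ → ⊥) →
          Visits N G′ c (a + x , b + y , fromS) → ExitsRow N G′ c r → suc r ≤ k →
          Reach N G₀ r₀ k G′ (a + x) (b + y)

-- Embed D in a large grid and maintain along the insertion the invariant that
-- (i) every pipe exits from the same row as in the initial grid, (ii) at every cross the vertical
-- pipe has the larger label and exits from a higher row than the horizontal one, (iii) the only
-- bump, if any, is the cell (a , b) of the next min-droop, and (iv) the pipe p with the r-turn at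
-- (a , b) exits from one of the first k rows.  As k ≤ d₁(π), the pipes exiting from the first k
-- rows have labels increasing downwards.  If p ran horizontally through a cross, the vertical pipe
-- v there would exit above p, hence also within the first k rows, so v < p, contradicting (ii).
-- In particular the cell (a , b + 1), which p enters from the west, is no cross, so y = 1.
-- Initially (ii) holds because two pipes of a BPD cross at most once; a width-one
-- min-droop only reroutes p inside its rectangle, and a cross-bump swap makes the two pipes
-- exchange their segments between the cross and the bump, and both preserve (i)–(iv).

module Submission where

open import Defs
open import Data.Bool using (Bool; true; false; _∧_; if_then_else_)
open import Data.Bool.Properties using (∧-zeroʳ)
open import Data.Empty using (⊥; ⊥-elim)
open import Data.Fin using (Fin; toℕ; fromℕ<)
open import Data.Fin.Permutation using (Permutation′; _⟨$⟩ʳ_; _⟨$⟩ˡ_; inverseˡ; inverseʳ)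
open import Data.Fin.Properties using (toℕ-fromℕ<; toℕ-injective; toℕ<n; fromℕ<-toℕ)
open import Data.List using (List; []; _∷_)
open import Data.List.Membership.Propositional using (_∈_)
open import Data.List.Relation.Unary.Any using (here; there)
open import Data.Maybe using (Maybe; just; nothing)
open import Data.Maybe.Properties using (just-injective)
open import Data.Nat
open import Data.Nat.Properties
open import Data.Product using (Σ; _×_; _,_; proj₁; proj₂)
open import Data.Sum using (_⊎_; inj₁; inj₂)
open import Function using (case_of_)
open import Relation.Binary.Definitions using (tri<; tri≈; tri>)
open import Relation.Binary.PropositionalEquality
open import Relation.Nullary using (¬_; Dec; yes; no)
open import Relation.Nullary.Decidable using (_×-dec_; _⊎-dec_)

fromS≢fromW : fromS ≢ fromW
fromS≢fromW ()

fromW≢fromS : fromW ≢ fromS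
fromW≢fromS ()

m<n⇒pred[n]<n : ∀ {m n} → m < n → pred n < n
m<n⇒pred[n]<n {n = suc n} _ = n<1+n n

pred[m]<n⇒m≤n : ∀ {m n} → pred m < n → m ≤ n
pred[m]<n⇒m≤n {zero} _ = z≤n
pred[m]<n⇒m≤n {suc m} l = l

m∸n≡suc[m∸suc[n]] : ∀ m n → suc n ≤ m → m ∸ n ≡ suc (m ∸ suc n)
m∸n≡suc[m∸suc[n]] (suc m) zero _ = refl
m∸n≡suc[m∸suc[n]] (suc m) (suc n) (s≤s le) = m∸n≡suc[m∸suc[n]] m n le

routeAt : Grid → Cell → Maybe Out
routeAt G (i , j , d) = route (G i j) d

module Pipes (N : ℕ) (G : Grid) where
  data Step : Cell → Cell → Set where
    stN : ∀ {i j d} → route (G (suc i) j) d ≡ just toN → Step (suc i , j , d) (i , j , fromS)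
    stE : ∀ {i j d} → route (G i j) d ≡ just toE → suc j < N → Step (i , j , d) (i , suc j , fromW)

  data Final : Cell → ℕ → Set where
    fin : ∀ {i j d} → route (G i j) d ≡ just toE → ¬ (suc j < N) → Final (i , j , d) i

  -- Walks along the pipes, built from the front (Fwd, convenient for induction along the rest of
  -- a pipe) or from the back (Path, convenient for "pipe c reaches cell y").
  infixr 5 _∷_
  data Fwd : Cell → Cell → Set where
    [] : ∀ {x} → Fwd x x
    _∷_ : ∀ {x y z} → Step x y → Fwd y z → Fwd x z

  infixl 5 _▸_
  data Path : Cell → Cell → Set where
    ε : ∀ {x} → Path x x
    _▸_ : ∀ {x y z} → Path x y → Step y z → Path x z

  fwd-snoc : ∀ {x y z} → Fwd x y → Step y z → Fwd x z
  fwd-snoc [] s = s ∷ []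
  fwd-snoc (t ∷ p) s = t ∷ fwd-snoc p s

  path-cons : ∀ {x y z} → Step x y → Path y z → Path x z
  path-cons s ε = ε ▸ s
  path-cons s (p ▸ t) = path-cons s p ▸ t

  toFwd : ∀ {x y} → Path x y → Fwd x y
  toFwd ε = []
  toFwd (p ▸ s) = fwd-snoc (toFwd p) s

  toPath : ∀ {x y} → Fwd x y → Path x y
  toPath [] = ε
  toPath (s ∷ p) = path-cons s (toPath p)

  _++ᵖ_ : ∀ {x y z} → Path x y → Path y z → Path x z
  p ++ᵖ ε = p
  p ++ᵖ (q ▸ s) = (p ++ᵖ q) ▸ s

  _++ᶠ_ : ∀ {x y z} → Fwd x y → Fwd y z → Fwd x z
  [] ++ᶠ g = g
  (s ∷ f) ++ᶠ g = s ∷ (f ++ᶠ g)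

  step-det : ∀ {x y y′} → Step x y → Step x y′ → y ≡ y′
  step-det (stN e) (stN e′) = refl
  step-det (stN e) (stE e′ _) = case trans (sym e) e′ of λ ()
  step-det (stE e _) (stN e′) = case trans (sym e) e′ of λ ()
  step-det (stE e _) (stE e′ _) = refl

  final-nostep : ∀ {x y r} → Final x r → Step x y → ⊥
  final-nostep (fin e eq) (stN e′) with trans (sym e) e′
  ... | ()
  final-nostep (fin e nlt) (stE e′ lt) = nlt lt

  final-det : ∀ {x r r′} → Final x r → Final x r′ → r ≡ r′
  final-det (fin _ _) (fin _ _) = refl

  trace-sound : ∀ f i j d {ps r} → trace f N G i j d ≡ just (ps , r) →
               (Σ Cell λ z → Fwd (i , j , d) z × Final z r) × (∀ y → y ∈ ps → Fwd (i , j , d) y)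
  trace-sound zero i j d ()
  trace-sound (suc f) i j d eq with route (G i j) d in e
  ... | nothing = case eq of λ ()
  ... | just toN with i
  ...   | zero = case eq of λ ()
  ...   | suc i′ with trace f N G i′ j fromS in e2
  ...     | nothing = case eq of λ ()
  ...     | just (ps′ , r′) with just-injective eq
  ...       | refl with trace-sound f i′ j fromS e2
  ...         | (z , p , fz) , mem = (z , stN e ∷ p , fz) , λ { y (here refl) → [] ; y (there m) → stN e ∷ mem y m }
  trace-sound (suc f) i j d eq | just toE with suc j <? N
  ...   | yes lt with trace f N G i (suc j) fromW in e2
  ...     | nothing = case eq of λ ()
  ...     | just (ps′ , r′) with just-injective eq
  ...       | refl with trace-sound f i (suc j) fromW e2
  ...         | (z , p , fz) , mem = (z , stE e lt ∷ p , fz) , λ { y (here refl) → [] ; y (there m) → stE e lt ∷ mem y m }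
  trace-sound (suc f) i j d eq | just toE | no nlt with just-injective eq
  ...     | refl = ((i , j , d) , [] , fin e nlt) , λ { y (here refl) → [] }

  trace-complete : ∀ f i j d {z r} → Fwd (i , j , d) z → Final z r → i + (N ∸ j) < f →
                  Σ (List Cell) λ ps → trace f N G i j d ≡ just (ps , r)
  trace-complete zero i j d p fz ()
  trace-complete (suc f) i j d [] (fin e nlt) lt with route (G i j) d | e
  ... | .(just toE) | refl with suc j <? N
  ...   | yes l = ⊥-elim (nlt l)
  ...   | no _ = _ , refl
  trace-complete (suc f) (suc i) j d (stN e ∷ p) fz lt with route (G (suc i) j) d | e
  ... | .(just toN) | refl with trace-complete f i j fromS p fz (s≤s⁻¹ lt)
  ...   | ps , eq rewrite eq = _ , refl
  trace-complete (suc f) i j d (stE e l ∷ p) fz lt with route (G i j) d | e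
  ... | .(just toE) | refl with suc j <? N
  ...   | no nl = ⊥-elim (nl l)
  ...   | yes _ with trace-complete f i (suc j) fromW p fz lt′
    where
    lt′ : i + (N ∸ suc j) < f
    lt′ = subst (_≤ f) (trans (cong (i +_) (m∸n≡suc[m∸suc[n]] N j (<⇒≤ l))) (+-suc i _)) (s≤s⁻¹ lt)
  ...     | ps , eq rewrite eq = _ , refl

  trace-contains : ∀ f i j d {ps r y} → trace f N G i j d ≡ just (ps , r) → Fwd (i , j , d) y → y ∈ ps
  trace-contains zero i j d () p
  trace-contains (suc f) i j d eq p with route (G i j) d in e
  ... | nothing = case eq of λ ()
  ... | just toN with i
  ...   | zero = case eq of λ ()
  ...   | suc i′ with trace f N G i′ j fromS in e2
  ...     | nothing = case eq of λ ()
  ...     | just (ps′ , r′) with just-injective eq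
  ...       | refl with p
  ...         | [] = here refl
  ...         | stN e3 ∷ p′ = there (trace-contains f i′ j fromS e2 p′)
  ...         | stE e3 _ ∷ p′ with trans (sym e) e3
  ...           | ()
  trace-contains (suc f) i j d eq p | just toE with suc j <? N
  ...   | yes lt with trace f N G i (suc j) fromW in e2
  ...     | nothing = case eq of λ ()
  ...     | just (ps′ , r′) with just-injective eq
  ...       | refl with p
  ...         | [] = here refl
  ...         | stE e3 _ ∷ p′ = there (trace-contains f i (suc j) fromW e2 p′)
  ...         | stN e3 ∷ p′ with trans (sym e) e3
  ...           | ()
  trace-contains (suc f) i j d eq p | just toE | no nlt with just-injective eq
  ...     | refl with p
  ...       | [] = here refl
  ...       | stE e3 l ∷ p′ = ⊥-elim (nlt l)
  ...       | stN e3 ∷ p′ with trans (sym e) e3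
  ...         | ()

  cmp : ∀ {x y y′} → Fwd x y → Fwd x y′ → Fwd y y′ ⊎ Fwd y′ y
  cmp [] q = inj₁ q
  cmp p [] = inj₂ p
  cmp (s ∷ p) (t ∷ q) with step-det s t
  ... | refl = cmp p q

  before-final : ∀ {x y z r} → Fwd x y → Fwd x z → Final z r → Fwd y z
  before-final p q fz with cmp p q
  ... | inj₁ r = r
  ... | inj₂ [] = []
  ... | inj₂ (s ∷ _) = ⊥-elim (final-nostep fz s)

  final-unique : ∀ {x z z′ r r′} → Fwd x z → Final z r → Fwd x z′ → Final z′ r′ → r ≡ r′
  final-unique p fz q fz′ with before-final p q fz′
  ... | [] = final-det fz fz′
  ... | s ∷ _ = ⊥-elim (final-nostep fz s)

  row col : Cell → ℕ
  row (i , j , d) = i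
  col (i , j , d) = j

  step-mono : ∀ {x y} → Step x y → (row y < row x × col x ≡ col y) ⊎ (row y ≡ row x × col x < col y)
  step-mono (stN _) = inj₁ (≤-refl , refl)
  step-mono (stE _ _) = inj₂ (refl , ≤-refl)

  fwd-mono : ∀ {x y} → Fwd x y → row y ≤ row x × col x ≤ col y
  fwd-mono [] = ≤-refl , ≤-refl
  fwd-mono (s ∷ p) with step-mono s | fwd-mono p
  ... | inj₁ (a , b) | c , d = ≤-trans c (<⇒≤ a) , subst (_≤ _) (sym b) d
  ... | inj₂ (a , b) | c , d = subst (_ ≤_) a c , ≤-trans (<⇒≤ b) d

  fwd-strict : ∀ {x y z} → Step x y → Fwd y z → row z < row x ⊎ col x < col z
  fwd-strict s p with step-mono s | fwd-mono p
  ... | inj₁ (a , b) | c , d = inj₁ (≤-<-trans c a)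
  ... | inj₂ (a , b) | c , d = inj₂ (<-≤-trans b d)

  step-no-return : ∀ {i j d d′ w} → Step (i , j , d) w → Fwd w (i , j , d′) → ⊥
  step-no-return s f with fwd-strict s f
  ... | inj₁ lt = <-irrefl refl lt
  ... | inj₂ lt = <-irrefl refl lt

  path-mono : ∀ {x y} → Path x y → row y ≤ row x × col x ≤ col y
  path-mono p = fwd-mono (toFwd p)

  same-cell : ∀ {i j d d′} → Fwd (i , j , d) (i , j , d′) → d ≡ d′
  same-cell [] = refl
  same-cell (s ∷ p) = ⊥-elim (step-no-return s p)

  fwd-antisym : ∀ {x y} → Fwd x y → Fwd y x → x ≡ y
  fwd-antisym [] q = refl
  fwd-antisym (s ∷ p) q with fwd-strict s p | fwd-mono q
  ... | inj₁ lt | a , b = ⊥-elim (<-irrefl refl (<-≤-trans lt a))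
  ... | inj₂ lt | a , b = ⊥-elim (<-irrefl refl (<-≤-trans lt b))

  route-inj : ∀ t d d′ {o} → route t d ≡ just o → route t d′ ≡ just o → d ≡ d′
  route-inj t fromS fromS _ _ = refl
  route-inj t fromW fromW _ _ = refl
  route-inj blank fromS fromW () _
  route-inj hor fromS fromW () _
  route-inj ver fromS fromW _ ()
  route-inj cross fromS fromW refl ()
  route-inj rel fromS fromW _ ()
  route-inj jel fromS fromW () _
  route-inj bump fromS fromW refl ()
  route-inj blank fromW fromS () _
  route-inj hor fromW fromS _ ()
  route-inj ver fromW fromS () _
  route-inj cross fromW fromS refl ()
  route-inj rel fromW fromS () _
  route-inj jel fromW fromS _ ()
  route-inj bump fromW fromS refl ()

  step-backward-det : ∀ {x x′ y} → Step x y → Step x′ y → x ≡ x′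
  step-backward-det {suc i , j , d} {suc .i , .j , d′} (stN e) (stN e′) rewrite route-inj (G (suc i) j) d d′ e e′ = refl
  step-backward-det {i , j , d} {.i , .j , d′} (stE e _) (stE e′ _) rewrite route-inj (G i j) d d′ e e′ = refl

  src : ℕ → Cell
  src c = (N ∸ 1 , c , fromS)

  pipe-inj : ∀ {c c′ y} → Path (src c) y → Path (src c′) y → c ≡ c′
  pipe-inj ε ε = refl
  pipe-inj (p ▸ s) (q ▸ t) with step-backward-det s t
  ... | refl = pipe-inj p q
  pipe-inj ε (q ▸ stN e) = ⊥-elim (<-irrefl refl (proj₁ (path-mono q)))
  pipe-inj (p ▸ stN e) ε = ⊥-elim (<-irrefl refl (proj₁ (path-mono p)))

  Exits : ℕ → ℕ → Set
  Exits c r = Σ Cell λ z → Path (src c) z × Final z r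

  exits-unique : ∀ {c r r′} → Exits c r → Exits c r′ → r ≡ r′
  exits-unique (z , p , fz) (z′ , q , fz′) = final-unique (toFwd p) fz (toFwd q) fz′

  start-fuel : ∀ c → c < N → (N ∸ 1) + (N ∸ c) < N + N
  start-fuel c lt = +-mono-<-≤ (m<n⇒pred[n]<n lt) (m∸n≤m N c)

  visits⇒path : ∀ {c x} → Visits N G c x → c < N × Path (src c) x × Σ ℕ (Exits c)
  visits⇒path {c} {x} (lt , ps , r , eq , m) with trace-sound (N + N) (N ∸ 1) c fromS eq
  ... | (z , p , fz) , mem = lt , toPath (mem x m) , r , z , toPath p , fz

  path⇒visits : ∀ {c x r} → c < N → Exits c r → Path (src c) x → Visits N G c x
  path⇒visits {c} {x} {r} lt (z , p , fz) q with trace-complete (N + N) (N ∸ 1) c fromS (toFwd p) fz (start-fuel c lt)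
  ... | ps , eq = lt , ps , r , eq , trace-contains (N + N) (N ∸ 1) c fromS eq (toFwd q)

  exitsRow⇒exits : ∀ {c r} → ExitsRow N G c r → c < N × Exits c r
  exitsRow⇒exits {c} (lt , ps , eq) with trace-sound (N + N) (N ∸ 1) c fromS eq
  ... | (z , p , fz) , _ = lt , z , toPath p , fz

module PipeRegions (N : ℕ) (G : Grid) where
  open Pipes N G

  On : ℕ → ℕ → ℕ → Set
  On c i j = Σ In λ d → Path (src c) (i , j , d)

  -- Pipe c occupies an interval of rows in every column j ≥ c, from ColBottom (where it enters
  -- the column) up to ColTop (where it turns east); this splits the grid into the cells Above
  -- (or left of) the pipe, those On it, and those Below it.
  ColTop : ℕ → ℕ → ℕ → Set
  ColTop c j t = Σ In λ d → Path (src c) (t , j , d) × route (G t j) d ≡ just toE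

  ColBottom : ℕ → ℕ → ℕ → Set
  ColBottom c j b = (j ≡ c × b ≡ N ∸ 1) ⊎ Path (src c) (b , j , fromW)

  Above : ℕ → ℕ → ℕ → Set
  Above c i j = j < c ⊎ Σ ℕ λ t → ColTop c j t × i < t

  Below : ℕ → ℕ → ℕ → Set
  Below c i j = Σ ℕ λ b → ColBottom c j b × b < i

  path-colN : ∀ {c y} → c < N → Path (src c) y → col y < N
  path-colN lt ε = lt
  path-colN lt (p ▸ stN _) = path-colN lt p
  path-colN lt (p ▸ stE _ l) = l

  path-rowN : ∀ {c y} → Path (src c) y → row y ≤ N ∸ 1
  path-rowN p = proj₁ (path-mono p)

  path-colc : ∀ {c y} → Path (src c) y → c ≤ col y
  path-colc p = proj₂ (path-mono p)

  findTop : ∀ {x z r} j → Fwd x z → Final z r → col x ≤ j → j < N →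
            Σ Cell λ y → Fwd x y × col y ≡ j × routeAt G y ≡ just toE
  findTop {i , jx , d} j [] (fin e nlt) le lt = (i , jx , d) , [] , ≤-antisym le (≮⇒≥ (λ l → nlt (≤-trans (s≤s l) lt))) , e
  findTop {i , jx , d} j (stN e ∷ p) fz le lt with findTop j p fz le lt
  ... | y , q , a , b = y , stN e ∷ q , a , b
  findTop {i , jx , d} j (stE e l ∷ p) fz le lt with jx ≟ j
  ... | yes refl = (i , jx , d) , [] , refl , e
  ... | no ne with findTop j p fz (≤∧≢⇒< le ne) lt
  ...   | y , q , a , b = y , stE e l ∷ q , a , b

  module OfPipe (c : ℕ) (cN : c < N) {r : ℕ} (cp : Exits c r) where
    zF : Cell
    zF = proj₁ cp
    pF : Path (src c) zF
    pF = proj₁ (proj₂ cp)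
    fF : Final zF r
    fF = proj₂ (proj₂ cp)

    top-exists : ∀ j → c ≤ j → j < N → Σ ℕ (ColTop c j)
    top-exists j le lt with findTop j (toFwd pF) fF le lt
    ... | (t , .j , d) , q , refl , e = t , d , toPath q , e

    on-before : ∀ {y} → Path (src c) y → Fwd y zF
    on-before p = before-final (toFwd p) (toFwd pF) fF

    cmpP : ∀ {y y′} → Path (src c) y → Path (src c) y′ → Fwd y y′ ⊎ Fwd y′ y
    cmpP p q = cmp (toFwd p) (toFwd q)

    top-le : ∀ {j t i} → ColTop c j t → On c i j → t ≤ i
    top-le {j} {t} {i} (d , p , e) (d′ , q) with cmpP p q
    ... | inj₂ f = proj₁ (fwd-mono f)
    ... | inj₁ [] = ≤-refl
    ... | inj₁ (stE _ _ ∷ f) = ⊥-elim (<-irrefl refl (<-≤-trans (n<1+n j) (proj₂ (fwd-mono f))))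
    ... | inj₁ (stN e′ ∷ f) with trans (sym e) e′
    ...   | ()

    top-unique : ∀ {j t t′} → ColTop c j t → ColTop c j t′ → t ≡ t′
    top-unique a@(d , p , _) b@(d′ , q , _) = ≤-antisym (top-le a (d′ , q)) (top-le b (d , p))

    bot-ge : ∀ {j b i} → ColBottom c j b → On c i j → i ≤ b
    bot-ge (inj₁ (refl , refl)) (d , q) = path-rowN q
    bot-ge {j} {b} {i} (inj₂ p) (d , q) with cmpP p q
    ... | inj₁ f = proj₁ (fwd-mono f)
    ... | inj₂ f with toPath f
    ...   | ε = ≤-refl
    ...   | f′ ▸ stE _ _ = ⊥-elim (<-irrefl refl (<-≤-trans (n<1+n _) (proj₂ (path-mono f′))))

    top-next : ∀ {j t} → ColTop c j t → suc j < N → Path (src c) (t , suc j , fromW)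
    top-next (d , p , e) l = p ▸ stE e l

    bot-exists : ∀ j → c ≤ j → j < N → Σ ℕ (ColBottom c j)
    bot-exists j le lt with m≤n⇒m<n∨m≡n le
    ... | inj₂ refl = N ∸ 1 , inj₁ (refl , refl)
    bot-exists (suc j) le lt | inj₁ l with top-exists j (s≤s⁻¹ l) (≤-trans (n≤1+n _) lt)
    ... | t , tp = t , inj₂ (top-next tp lt)

    noW-at-c : ∀ {b} → Path (src c) (b , c , fromW) → ⊥
    noW-at-c (q ▸ stE _ _) = <-irrefl refl (<-≤-trans (n<1+n _) (path-colc q))

    bot-unique : ∀ {j b b′} → ColBottom c j b → ColBottom c j b′ → b ≡ b′
    bot-unique (inj₁ (refl , refl)) (inj₁ (_ , refl)) = refl
    bot-unique (inj₁ (refl , refl)) (inj₂ q) = ⊥-elim (noW-at-c q)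
    bot-unique (inj₂ p) (inj₁ (refl , refl)) = ⊥-elim (noW-at-c p)
    bot-unique (inj₂ p) (inj₂ q) = ≤-antisym (bot-ge (inj₂ q) (fromW , p)) (bot-ge (inj₂ p) (fromW , q))

    bot-on : ∀ {j b} → ColBottom c j b → Σ In λ d → Path (src c) (b , j , d)
    bot-on (inj₁ (refl , refl)) = fromS , ε
    bot-on (inj₂ p) = fromW , p

    top≤bot : ∀ {j t b} → ColTop c j t → ColBottom c j b → t ≤ b
    top≤bot (d , p , _) bt = bot-ge bt (d , p)

    col-walk : ∀ {b j d t d′ i} → Fwd (b , j , d) (t , j , d′) → t ≤ i → i ≤ b → Σ In λ d″ → Fwd (b , j , d) (i , j , d″)
    col-walk {b} {i = i} [] le ge with ≤-antisym ge le
    ... | refl = _ , []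
    col-walk (stE _ _ ∷ f) le ge = ⊥-elim (<-irrefl refl (<-≤-trans (n<1+n _) (proj₂ (fwd-mono f))))
    col-walk {suc b} {i = i} (stN e ∷ f) le ge with i ≟ suc b
    ... | yes refl = _ , []
    ... | no ne with col-walk f le (s≤s⁻¹ (≤∧≢⇒< ge ne))
    ...   | d″ , g = d″ , stN e ∷ g

    contig : ∀ {j t b i} → ColTop c j t → ColBottom c j b → t ≤ i → i ≤ b → On c i j
    contig {j} tp@(d , p , e) bt le ge with bot-on bt
    ... | dB , q with cmpP q p
    ...   | inj₁ f with col-walk f le ge
    ...     | d″ , g = d″ , (q ++ᵖ toPath g)
    contig {j} tp@(d , p , e) bt le ge | dB , q | inj₂ [] = d , subst (λ k → Path (src c) (k , j , d)) (≤-antisym le ge) p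
    contig {j} tp@(d , p , e) bt le ge | dB , q | inj₂ (stE _ _ ∷ f) = ⊥-elim (<-irrefl refl (<-≤-trans (n<1+n _) (proj₂ (fwd-mono f))))
    contig {j} tp@(d , p , e) bt le ge | dB , q | inj₂ (stN e′ ∷ f) with trans (sym e) e′
    ... | ()

    on-colc : ∀ {i j} → On c i j → c ≤ j
    on-colc (_ , p) = path-colc p

    bot-col : ∀ {j b} → ColBottom c j b → c ≤ j × j < N
    bot-col bt with bot-on bt
    ... | d , p = path-colc p , path-colN cN p

    top-col : ∀ {j t} → ColTop c j t → c ≤ j × j < N
    top-col (d , p , _) = path-colc p , path-colN cN p

    above-not-on : ∀ {i j} → Above c i j → On c i j → ⊥
    above-not-on (inj₁ lt) on = <-irrefl refl (<-≤-trans lt (on-colc on))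
    above-not-on (inj₂ (t , tp , lt)) on = <-irrefl refl (<-≤-trans lt (top-le tp on))

    below-not-on : ∀ {i j} → Below c i j → On c i j → ⊥
    below-not-on (b , bt , lt) on = <-irrefl refl (<-≤-trans lt (bot-ge bt on))

    trichotomy : ∀ i j → j < N → i ≤ N ∸ 1 → Above c i j ⊎ On c i j ⊎ Below c i j
    trichotomy i j jN iN with j <? c
    ... | yes lt = inj₁ (inj₁ lt)
    ... | no nlt with top-exists j (≮⇒≥ nlt) jN | bot-exists j (≮⇒≥ nlt) jN
    ...   | t , tp | b , bt with i <? t
    ...     | yes lt = inj₁ (inj₂ (t , tp , lt))
    ...     | no nlt2 with b <? i
    ...       | yes lt = inj₂ (inj₂ (b , bt , lt))
    ...       | no nlt3 = inj₂ (inj₁ (contig tp bt (≮⇒≥ nlt2) (≮⇒≥ nlt3)))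

    below-step : ∀ {i j d y} → Below c i j → Step (i , j , d) y →
               Below c (row y) (col y) ⊎ (On c (row y) (col y) × proj₂ (proj₂ y) ≡ fromS)
    below-step {suc i} {j} (b , bt , lt) (stN e) with bot-col bt
    ... | cj , jN with top-exists j cj jN
    ...   | t , tp with b <? i
    ...     | yes l = inj₁ (b , bt , l)
    ...     | no nl = inj₂ (contig tp bt (≤-trans (top≤bot tp bt) (s≤s⁻¹ lt)) (≮⇒≥ nl) , refl)
    below-step {i} {j} (b , bt , lt) (stE e l) with bot-col bt
    ... | cj , jN with top-exists j cj jN
    ...   | t , tp = inj₁ (t , inj₂ (top-next tp l) , ≤-<-trans (top≤bot tp bt) lt)

    above-step : ∀ {i j d y} → i ≤ N ∸ 1 → Above c i j → Step (i , j , d) y →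
               Above c (row y) (col y) ⊎ (On c (row y) (col y) × proj₂ (proj₂ y) ≡ fromW)
    above-step {suc i} iN (inj₁ lt) (stN e) = inj₁ (inj₁ lt)
    above-step {suc i} iN (inj₂ (t , tp , lt)) (stN e) = inj₁ (inj₂ (t , tp , ≤-trans (n≤1+n _) lt))
    above-step {i} {j} iN (inj₁ lt) (stE e l) with suc j <? c
    ... | yes l2 = inj₁ (inj₁ l2)
    ... | no nl2 with ≤-antisym lt (≮⇒≥ nl2)
    ...   | refl with top-exists (suc j) ≤-refl l
    ...     | t′ , tp′ with i <? t′
    ...       | yes l3 = inj₁ (inj₂ (t′ , tp′ , l3))
    ...       | no nl3 = inj₂ (contig tp′ (inj₁ (refl , refl)) (≮⇒≥ nl3) iN , refl)
    above-step {i} {j} iN (inj₂ (t , tp , lt)) (stE e l) with top-col tp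
    ... | cj , jN with top-exists (suc j) (≤-trans cj (n≤1+n _)) l
    ...   | t′ , tp′ with i <? t′
    ...     | yes l3 = inj₁ (inj₂ (t′ , tp′ , l3))
    ...     | no nl3 = inj₂ (contig tp′ (inj₂ (top-next tp l)) (≮⇒≥ nl3) (<⇒≤ lt) , refl)

    on-route : ∀ {y} → Path (src c) y → Σ Out λ o → routeAt G y ≡ just o
    on-route p with on-before p
    ... | [] with fF
    ...   | fin e _ = toE , e
    on-route p | stN e ∷ _ = toN , e
    on-route p | stE e _ ∷ _ = toE , e

    route-diff : ∀ t d d′ {o o′} → route t d ≡ just o → route t d′ ≡ just o′ → d ≢ d′ → o ≢ o′
    route-diff t d d′ e e′ ne refl = ne (route-inj t d d′ e e′)

    shared-leave : ∀ {i j dP dQ y} → Path (src c) (i , j , dP) → dQ ≢ dP → Step (i , j , dQ) y →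
                   (route (G i j) dP ≡ just toE × Above c (row y) (col y)) ⊎
                   (route (G i j) dP ≡ just toN × Below c (row y) (col y))
    shared-leave {i} {j} {dP} {dQ} p ne s with on-route p
    shared-leave {suc i} {j} {dP} {dQ} p ne (stN e) | toE , eP =
      inj₁ (eP , inj₂ (suc i , (dP , p , eP) , ≤-refl))
    shared-leave {suc i} {j} {dP} {dQ} p ne (stN e) | toN , eP = ⊥-elim (route-diff (G (suc i) j) dQ dP e eP ne refl)
    shared-leave {i} {j} {dP} {dQ} p ne (stE e l) | toE , eP = ⊥-elim (route-diff (G i j) dQ dP e eP ne refl)
    shared-leave {zero} {j} {dP} {dQ} p ne (stE e l) | toN , eP with on-before p
    ... | [] with fF
    ...   | fin e2 _ with trans (sym eP) e2
    ...     | ()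
    shared-leave {zero} {j} {dP} {dQ} p ne (stE e l) | toN , eP | stE e2 _ ∷ _ with trans (sym eP) e2
    ... | ()
    shared-leave {suc i} {j} {dP} {dQ} p ne (stE e l) | toN , eP with top-exists j (path-colc p) (path-colN cN p)
    ... | t , tp = inj₂ (eP , t , inj₂ (top-next tp l) , s≤s (top-le tp (fromS , p ▸ stN eP)))

    topLast : ∀ {j} → suc j ≡ N → ColTop c j r
    topLast {j} eq with fF | pF
    ... | fin {i} {jF} {dF} e nlt | p = subst (λ k → ColTop c k r) jF≡j (dF , p , e)
      where
      jF≡j : jF ≡ j
      jF≡j = ≤-antisym (s≤s⁻¹ (subst (suc jF ≤_) (sym eq) (path-colN cN p))) (s≤s⁻¹ (subst (_≤ suc jF) (sym eq) (≮⇒≥ nlt)))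

    end-above : ∀ {i j} → suc j ≡ N → Above c i j → i < r
    end-above {i} {j} eq (inj₁ lt) = ⊥-elim (<-irrefl refl (<-≤-trans lt (proj₁ (top-col (topLast eq)))))
    end-above {i} {j} eq (inj₂ (t , tp , lt)) = subst (i <_) (top-unique tp (topLast eq)) lt

    pathW-col : ∀ {b j} → Path (src c) (b , j , fromW) → c < j
    pathW-col (q ▸ stE _ _) = s≤s (path-colc q)

    start-below : ∀ {cQ} → Below c (N ∸ 1) cQ → c < cQ
    start-below (b , inj₁ (refl , refl) , lt) = ⊥-elim (<-irrefl refl lt)
    start-below (b , inj₂ p , lt) = pathW-col p

    side : Cell → In
    side (_ , _ , d) = d

    walk-below : ∀ {y z} → Below c (row y) (col y) → Fwd y z →
               Below c (row z) (col z) ⊎ Σ Cell λ w → Fwd y w × Fwd w z × On c (row w) (col w) × side w ≡ fromS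
    walk-below bl [] = inj₁ bl
    walk-below {i , j , d} bl (s ∷ f) with below-step bl s
    ... | inj₂ (on , e) = inj₂ (_ , s ∷ [] , f , on , e)
    ... | inj₁ bl′ with walk-below bl′ f
    ...   | inj₁ r = inj₁ r
    ...   | inj₂ (w , g , h , on , e) = inj₂ (w , s ∷ g , h , on , e)

    walk-above : ∀ {y z} → row y ≤ N ∸ 1 → Above c (row y) (col y) → Fwd y z →
               Above c (row z) (col z) ⊎ Σ Cell λ w → Fwd y w × Fwd w z × On c (row w) (col w) × side w ≡ fromW
    walk-above rn ab [] = inj₁ ab
    walk-above {i , j , d} rn ab (s ∷ f) with above-step rn ab s
    ... | inj₂ (on , e) = inj₂ (_ , s ∷ [] , f , on , e)
    ... | inj₁ ab′ with walk-above (≤-trans (proj₁ (fwd-mono (s ∷ []))) rn) ab′ f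
    ...   | inj₁ r = inj₁ r
    ...   | inj₂ (w , g , h , on , e) = inj₂ (w , s ∷ g , h , on , e)

≡ᵇ-true : ∀ {m n} → m ≡ n → (m ≡ᵇ n) ≡ true
≡ᵇ-true {zero} {zero} refl = refl
≡ᵇ-true {suc m} {suc n} refl = ≡ᵇ-true {m} {n} refl

≡ᵇ-false : ∀ {m n} → m ≢ n → (m ≡ᵇ n) ≡ false
≡ᵇ-false {zero} {zero} ne = ⊥-elim (ne refl)
≡ᵇ-false {zero} {suc n} ne = refl
≡ᵇ-false {suc m} {zero} ne = refl
≡ᵇ-false {suc m} {suc n} ne = ≡ᵇ-false {m} {n} (λ e → ne (cong suc e))

<ᵇ-true : ∀ {m n} → m < n → (m <ᵇ n) ≡ true
<ᵇ-true {zero} {suc n} _ = refl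
<ᵇ-true {suc m} {suc n} (s≤s l) = <ᵇ-true {m} {n} l

<ᵇ-false : ∀ {m n} → ¬ (m < n) → (m <ᵇ n) ≡ false
<ᵇ-false {m} {zero} _ = refl
<ᵇ-false {zero} {suc n} nl = ⊥-elim (nl (s≤s z≤n))
<ᵇ-false {suc m} {suc n} nl = <ᵇ-false {m} {n} (λ l → nl (s≤s l))

module RouteTransfer (N : ℕ) (G G′ : Grid) where
  module B = Pipes N G
  module B′ = Pipes N G′

  transfer-step : ∀ {z w} → routeAt G′ z ≡ routeAt G z → B.Step z w → B′.Step z w
  transfer-step eq (B.stN e) = B′.stN (trans eq e)
  transfer-step eq (B.stE e l) = B′.stE (trans eq e) l

  transfer-step-side : ∀ {i j d d′ w} → route (G′ i j) d′ ≡ route (G i j) d → B.Step (i , j , d) w → B′.Step (i , j , d′) w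
  transfer-step-side eq (B.stN e) = B′.stN (trans eq e)
  transfer-step-side eq (B.stE e l) = B′.stE (trans eq e) l

  transfer-final : ∀ {z r} → routeAt G′ z ≡ routeAt G z → B.Final z r → B′.Final z r
  transfer-final eq (B.fin e nl) = B′.fin (trans eq e) nl

  transfer-prefix : ∀ {x y} → B.Path x y → (∀ {z w} → B.Path x z → B.Step z w → B.Fwd w y → routeAt G′ z ≡ routeAt G z) → B′.Path x y
  transfer-prefix B.ε h = B′.ε
  transfer-prefix (p B.▸ s) h = transfer-prefix p (λ pz sz fw → h pz sz (B.fwd-snoc fw s)) B′.▸ transfer-step (h p s B.[]) s

  transfer-fwd : ∀ {x y} → B.Fwd x y → (∀ {z w} → B.Fwd x z → B.Step z w → B.Fwd w y → routeAt G′ z ≡ routeAt G z) → B′.Fwd x y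
  transfer-fwd B.[] h = B′.[]
  transfer-fwd (s B.∷ p) h = transfer-step (h B.[] s p) s B′.∷ transfer-fwd p (λ fz sz fw → h (s B.∷ fz) sz fw)

  transfer-path : ∀ {x y} → (∀ z → B.Path x z → routeAt G′ z ≡ routeAt G z) → B.Path x y → B′.Path x y
  transfer-path h p = transfer-prefix p (λ pz _ _ → h _ pz)

  transfer-path⁻¹ : ∀ {x y} → (∀ z → B.Path x z → routeAt G′ z ≡ routeAt G z) → B′.Path x y → B.Path x y
  transfer-path⁻¹ h B′.ε = B.ε
  transfer-path⁻¹ h (p B′.▸ s) with transfer-path⁻¹ h p
  ... | q = q B.▸ stepB (h _ q) s
    where
    stepB : ∀ {z w} → routeAt G′ z ≡ routeAt G z → B′.Step z w → B.Step z w
    stepB eq (B′.stN e) = B.stN (trans (sym eq) e)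
    stepB eq (B′.stE e l) = B.stE (trans (sym eq) e) l

  transfer-exits : ∀ {c r} → (∀ z → B.Path (B.src c) z → routeAt G′ z ≡ routeAt G z) → B.Exits c r → B′.Exits c r
  transfer-exits h (z , p , fz) = z , transfer-path h p , transfer-final (h z p) fz

module SharedCells (N : ℕ) (G : Grid) where
  open Pipes N G

  pred-S : ∀ {c i j} → Path (src c) (i , j , fromS) → suc i ≤ N ∸ 1 →
           Σ In λ d → Path (src c) (suc i , j , d) × route (G (suc i) j) d ≡ just toN
  pred-S ε le = ⊥-elim (<-irrefl refl le)
  pred-S (p ▸ stN e) le = _ , p , e

  pred-W : ∀ {c i j} → Path (src c) (i , suc j , fromW) →
           Σ In λ d → Path (src c) (i , j , d) × route (G i j) d ≡ just toE
  pred-W (p ▸ stE e _) = _ , p , e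

  same-side : ∀ {c i j d d′} → Path (src c) (i , j , d) → Path (src c) (i , j , d′) → d ≡ d′
  same-side p q with cmp (toFwd p) (toFwd q)
  ... | inj₁ f = same-cell f
  ... | inj₂ f = sym (same-cell f)

  diff-pipes : ∀ {u v i j du dv} → Path (src u) (i , j , du) → Path (src v) (i , j , dv) → u ≢ v → du ≢ dv
  diff-pipes p q ne refl = ne (pipe-inj p q)

  two-sides : ∀ t {o o′} → route t fromS ≡ just o → route t fromW ≡ just o′ → t ≡ cross ⊎ t ≡ bump
  two-sides cross _ _ = inj₁ refl
  two-sides bump _ _ = inj₂ refl
  two-sides blank () _
  two-sides hor () _
  two-sides ver _ ()
  two-sides rel _ ()
  two-sides jel () _

-- Exit rows are always compared in the initial grid G₀, where they are fixed once and for all.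
module Invariant (N : ℕ) (G₀ : Grid) (k : ℕ) where
  module B₀ = Pipes N G₀

  ExitsAbove : ℕ → ℕ → Set
  ExitsAbove v h = ∀ rv rh → B₀.Exits v rv → B₀.Exits h rh → rv < rh

  ExitsPreserved : Grid → Set
  ExitsPreserved G = ∀ c → c < N → Σ ℕ λ r → B₀.Exits c r × Pipes.Exits N G c r

  CrossesOrdered : Grid → Set
  CrossesOrdered G = ∀ i j h → G i j ≡ cross → h < N → Pipes.Path N G (Pipes.src N G h) (i , j , fromW) →
         Σ ℕ λ v → v < N × Pipes.Path N G (Pipes.src N G v) (i , j , fromS) × h < v × ExitsAbove v h

  Core : Grid → Set
  Core G = ExitsPreserved G × CrossesOrdered G

  BumpOnlyAt : Grid → ℕ → ℕ → Set
  BumpOnlyAt G a b = ∀ i j → G i j ≡ bump → i ≡ a × j ≡ b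

  ExitsAboveK : ℕ → Set
  ExitsAboveK p = p < N × (∀ r → B₀.Exits p r → r < k)

  LabelsIncreasing : Set
  LabelsIncreasing = ∀ u v ru rv → B₀.Exits u ru → B₀.Exits v rv → ru < rv → rv < k → u < v

  DroopInvariant : Grid → ℕ → ℕ → Set
  DroopInvariant G a b = Core G × BumpOnlyAt G a b × Σ ℕ λ p → ExitsAboveK p × Pipes.Path N G (Pipes.src N G p) (a , b , fromS)

  module _ (mono : LabelsIncreasing) {G : Grid} (core : Core G) where
    open Pipes N G
    no-horizontal-cross : ∀ {p i j} → ExitsAboveK p → Path (src p) (i , j , fromW) → G i j ≡ cross → ⊥
    no-horizontal-cross {p} {i} {j} (pN , kp) pp cr with proj₂ core i j p cr pN pp
    ... | v , vN , pv , p<v , el with proj₁ core v vN | proj₁ core p pN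
    ...   | rv , cv₀ , _ | rp , cp₀ , _ = <-irrefl refl (<-trans p<v (mono v p rv rp cv₀ cp₀ (el rv rp cv₀ cp₀) (kp rp cp₀)))

b<b+1 : ∀ b → b < b + 1
b<b+1 b = m<m+n b (s≤s z≤n)

strictly-between-b-and-b+1 : ∀ b j → ((b <ᵇ j) ∧ (j <ᵇ b + 1)) ≡ false
strictly-between-b-and-b+1 b j with b <? j
... | no nl rewrite <ᵇ-false nl = refl
... | yes l rewrite <ᵇ-true l = <ᵇ-false (λ l2 → <-irrefl refl (<-≤-trans l (s≤s⁻¹ (subst (suc j ≤_) (+-comm b 1) l2))))

module DroopTileAt (G : Grid) (a b x : ℕ) (hx : 0 < x) where
  a<ax : a < a + x
  a<ax = m<m+n a hx

  dt-ab : droopTile G a b x 1 a b ≡ removeSE (G a b)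
  dt-ab rewrite ≡ᵇ-true {a} refl | ≡ᵇ-true {b} refl = refl

  dt-axb : droopTile G a b x 1 (a + x) b ≡ turnNE (G (a + x) b)
  dt-axb rewrite ≡ᵇ-false {a + x} {a} (>⇒≢ a<ax) | ≡ᵇ-true {a + x} refl | ≡ᵇ-true {b} refl = refl

  dt-mid : ∀ t → 0 < t → t < x → droopTile G a b x 1 (a + t) b ≡ dropV (G (a + t) b)
  dt-mid t h0 hx′ rewrite ≡ᵇ-false {a + t} {a} (>⇒≢ (m<m+n a h0)) | ≡ᵇ-false {a + t} {a + x} (<⇒≢ (+-monoʳ-< a hx′))
    | ≡ᵇ-true {b} refl | <ᵇ-true (m<m+n a h0) | <ᵇ-true (+-monoʳ-< a hx′) = refl

  dt-axb1 : droopTile G a b x 1 (a + x) (b + 1) ≡ addWN (G (a + x) (b + 1))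
  dt-axb1 rewrite ≡ᵇ-false {a + x} {a} (>⇒≢ a<ax) | ≡ᵇ-true {a + x} refl | ≡ᵇ-false {b + 1} {b} (>⇒≢ (b<b+1 b))
    | <ᵇ-true (b<b+1 b) | <ᵇ-false {b + 1} {b + 1} (<-irrefl refl) | ≡ᵇ-true {b + 1} refl = refl

  dt-mid1 : ∀ t → 0 < t → t < x → droopTile G a b x 1 (a + t) (b + 1) ≡ addV (G (a + t) (b + 1))
  dt-mid1 t h0 hx′ rewrite ≡ᵇ-false {a + t} {a} (>⇒≢ (m<m+n a h0)) | ≡ᵇ-false {a + t} {a + x} (<⇒≢ (+-monoʳ-< a hx′))
    | ≡ᵇ-false {b + 1} {b} (>⇒≢ (b<b+1 b)) | ≡ᵇ-true {b + 1} refl | <ᵇ-true (m<m+n a h0) | <ᵇ-true (+-monoʳ-< a hx′) = refl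

  dt-ab1 : droopTile G a b x 1 a (b + 1) ≡ turnWS (G a (b + 1))
  dt-ab1 rewrite ≡ᵇ-true {a} refl | ≡ᵇ-false {b + 1} {b} (>⇒≢ (b<b+1 b)) | ≡ᵇ-false {a} {a + x} (<⇒≢ a<ax)
    | <ᵇ-true (b<b+1 b) | <ᵇ-false {b + 1} {b + 1} (<-irrefl refl) | ≡ᵇ-true {b + 1} refl | <ᵇ-false {a} {a} (<-irrefl refl) = refl

  dt-outA : ∀ i j → j ≢ b → j ≢ b + 1 → droopTile G a b x 1 i j ≡ just (G i j)
  dt-outA i j n1 n2 rewrite strictly-between-b-and-b+1 b j | ≡ᵇ-false {j} {b} n1 | ≡ᵇ-false {j} {b + 1} n2
    | ∧-zeroʳ (i ≡ᵇ a) | ∧-zeroʳ (i ≡ᵇ a + x) = refl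

  dt-outB : ∀ i j → i < a → droopTile G a b x 1 i j ≡ just (G i j)
  dt-outB i j l rewrite ≡ᵇ-false {i} {a} (<⇒≢ l) | ≡ᵇ-false {i} {a + x} (<⇒≢ (<-≤-trans l (m≤m+n a x)))
    | <ᵇ-false {a} {i} (λ l2 → <-asym l l2) | ∧-zeroʳ (j ≡ᵇ b) | ∧-zeroʳ (j ≡ᵇ b + 1) = refl

  dt-outC : ∀ i j → a + x < i → droopTile G a b x 1 i j ≡ just (G i j)
  dt-outC i j l rewrite ≡ᵇ-false {i} {a} (>⇒≢ (≤-<-trans (m≤m+n a x) l)) | ≡ᵇ-false {i} {a + x} (>⇒≢ l)
    | <ᵇ-false {i} {a + x} (λ l2 → <-asym l l2) | ∧-zeroʳ (a <ᵇ i) | ∧-zeroʳ (j ≡ᵇ b) | ∧-zeroʳ (j ≡ᵇ b + 1) = refl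

removeSE-inv : ∀ {t t′} → removeSE t ≡ just t′ → (t ≡ rel × t′ ≡ blank) ⊎ (t ≡ bump × t′ ≡ jel)
removeSE-inv {rel} refl = inj₁ (refl , refl)
removeSE-inv {bump} refl = inj₂ (refl , refl)
removeSE-inv {blank} ()
removeSE-inv {hor} ()
removeSE-inv {ver} ()
removeSE-inv {cross} ()
removeSE-inv {jel} ()

turnNE-inv : ∀ {t t′} → turnNE t ≡ just t′ → (t ≡ ver × t′ ≡ rel) ⊎ (t ≡ jel × t′ ≡ hor)
turnNE-inv {ver} refl = inj₁ (refl , refl)
turnNE-inv {jel} refl = inj₂ (refl , refl)
turnNE-inv {blank} ()
turnNE-inv {hor} ()
turnNE-inv {cross} ()
turnNE-inv {rel} ()
turnNE-inv {bump} ()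

dropV-inv : ∀ {t t′} → dropV t ≡ just t′ → t ≡ cross × t′ ≡ hor
dropV-inv {cross} refl = refl , refl
dropV-inv {blank} ()
dropV-inv {hor} ()
dropV-inv {ver} ()
dropV-inv {rel} ()
dropV-inv {jel} ()
dropV-inv {bump} ()

addWN-inv : ∀ {t t′} → addWN t ≡ just t′ → (t ≡ blank × t′ ≡ jel) ⊎ (t ≡ rel × t′ ≡ bump)
addWN-inv {blank} refl = inj₁ (refl , refl)
addWN-inv {rel} refl = inj₂ (refl , refl)
addWN-inv {hor} ()
addWN-inv {ver} ()
addWN-inv {cross} ()
addWN-inv {jel} ()
addWN-inv {bump} ()

addV-inv : ∀ {t t′} → addV t ≡ just t′ → (t ≡ hor × t′ ≡ cross) ⊎ (t ≡ blank × t′ ≡ ver)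
addV-inv {hor} refl = inj₁ (refl , refl)
addV-inv {blank} refl = inj₂ (refl , refl)
addV-inv {ver} ()
addV-inv {cross} ()
addV-inv {rel} ()
addV-inv {jel} ()
addV-inv {bump} ()

turnWS-inv : ∀ {t t′} → turnWS t ≡ just t′ → (t ≡ jel × t′ ≡ ver) ⊎ (t ≡ hor × t′ ≡ rel)
turnWS-inv {jel} refl = inj₁ (refl , refl)
turnWS-inv {hor} refl = inj₂ (refl , refl)
turnWS-inv {blank} ()
turnWS-inv {ver} ()
turnWS-inv {cross} ()
turnWS-inv {rel} ()
turnWS-inv {bump} ()

module DroopTiles (G G′ : Grid) (a b x : ℕ) (hx : 0 < x)
  (hdt : ∀ i j → droopTile G a b x 1 i j ≡ just (G′ i j)) where
  open DroopTileAt G a b x hx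

  InRect : ℕ → ℕ → Set
  InRect i j = a ≤ i × i ≤ a + x × (j ≡ b ⊎ j ≡ suc b)

  T-ab : (G a b ≡ rel × G′ a b ≡ blank) ⊎ (G a b ≡ bump × G′ a b ≡ jel)
  T-ab = removeSE-inv (trans (sym dt-ab) (hdt a b))

  T-axb : (G (a + x) b ≡ ver × G′ (a + x) b ≡ rel) ⊎ (G (a + x) b ≡ jel × G′ (a + x) b ≡ hor)
  T-axb = turnNE-inv (trans (sym dt-axb) (hdt (a + x) b))

  T-mid : ∀ t → 0 < t → t < x → G (a + t) b ≡ cross × G′ (a + t) b ≡ hor
  T-mid t h0 h1 = dropV-inv (trans (sym (dt-mid t h0 h1)) (hdt (a + t) b))

  T-axb1 : (G (a + x) (suc b) ≡ blank × G′ (a + x) (suc b) ≡ jel) ⊎ (G (a + x) (suc b) ≡ rel × G′ (a + x) (suc b) ≡ bump)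
  T-axb1 = addWN-inv (subst (λ j → addWN (G (a + x) j) ≡ just (G′ (a + x) j)) (+-comm b 1) (trans (sym dt-axb1) (hdt (a + x) (b + 1))))

  T-mid1 : ∀ t → 0 < t → t < x → (G (a + t) (suc b) ≡ hor × G′ (a + t) (suc b) ≡ cross) ⊎ (G (a + t) (suc b) ≡ blank × G′ (a + t) (suc b) ≡ ver)
  T-mid1 t h0 h1 = addV-inv (subst (λ j → addV (G (a + t) j) ≡ just (G′ (a + t) j)) (+-comm b 1) (trans (sym (dt-mid1 t h0 h1)) (hdt (a + t) (b + 1))))

  T-ab1 : (G a (suc b) ≡ jel × G′ a (suc b) ≡ ver) ⊎ (G a (suc b) ≡ hor × G′ a (suc b) ≡ rel)
  T-ab1 = turnWS-inv (subst (λ j → turnWS (G a j) ≡ just (G′ a j)) (+-comm b 1) (trans (sym dt-ab1) (hdt a (b + 1))))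

  T-out : ∀ i j → ¬ InRect i j → G′ i j ≡ G i j
  T-out i j nr with j ≟ b | j ≟ suc b
  ... | no n1 | no n2 = sym (just-injective (trans (sym (dt-outA i j n1 (λ e → n2 (trans e (+-comm b 1))))) (hdt i j)))
  ... | yes e | _ = outAB (inj₁ e)
    where
    outAB : j ≡ b ⊎ j ≡ suc b → G′ i j ≡ G i j
    outAB ej with i <? a | a + x <? i
    ... | yes l | _ = sym (just-injective (trans (sym (dt-outB i j l)) (hdt i j)))
    ... | no _ | yes l = sym (just-injective (trans (sym (dt-outC i j l)) (hdt i j)))
    ... | no n1 | no n2 = ⊥-elim (nr (≮⇒≥ n1 , ≮⇒≥ n2 , ej))
  ... | no _ | yes e = outAB (inj₂ e)
    where
    outAB : j ≡ b ⊎ j ≡ suc b → G′ i j ≡ G i j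
    outAB ej with i <? a | a + x <? i
    ... | yes l | _ = sym (just-injective (trans (sym (dt-outB i j l)) (hdt i j)))
    ... | no _ | yes l = sym (just-injective (trans (sym (dt-outC i j l)) (hdt i j)))
    ... | no n1 | no n2 = ⊥-elim (nr (≮⇒≥ n1 , ≮⇒≥ n2 , ej))

  data RectCell : ℕ → ℕ → Set where
    rAB : RectCell a b
    rAXB : RectCell (a + x) b
    rMid : ∀ t → 0 < t → t < x → RectCell (a + t) b
    rAXB1 : RectCell (a + x) (suc b)
    rMid1 : ∀ t → 0 < t → t < x → RectCell (a + t) (suc b)
    rAB1 : RectCell a (suc b)

  classify : ∀ {i j} → InRect i j → RectCell i j
  classify {i} {j} (l1 , l2 , ej) with m≤n⇒m<n∨m≡n l1 | m≤n⇒m<n∨m≡n l2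
  ... | inj₂ refl | _ with ej
  ...   | inj₁ refl = rAB
  ...   | inj₂ refl = rAB1
  classify {i} {j} (l1 , l2 , ej) | inj₁ _ | inj₂ refl with ej
  ...   | inj₁ refl = rAXB
  ...   | inj₂ refl = rAXB1
  classify {i} {j} (l1 , l2 , ej) | inj₁ l3 | inj₁ l4 with m≤n⇒∃[o]m+o≡n l1
  ... | t , refl with ej
  ...   | inj₁ refl = rMid t (+-cancelˡ-< a 0 t (subst (_< a + t) (sym (+-identityʳ a)) l3)) (+-cancelˡ-< a t x l4)
  ...   | inj₂ refl = rMid1 t (+-cancelˡ-< a 0 t (subst (_< a + t) (sym (+-identityʳ a)) l3)) (+-cancelˡ-< a t x l4)

module DroopStep (N : ℕ) (G₀ : Grid) (k : ℕ) (G G′ : Grid) (a b x′ p : ℕ)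
  (core : Invariant.Core N G₀ k G) (bumps : Invariant.BumpOnlyAt N G₀ k G a b) (kp : Invariant.ExitsAboveK N G₀ k p)
  (pa : Pipes.Path N G (Pipes.src N G p) (a , b , fromS))
  (hax : a + suc x′ < N) (hb1 : suc b < N)
  (hdt : ∀ i j → droopTile G a b (suc x′) 1 i j ≡ just (G′ i j)) where

  x : ℕ
  x = suc x′
  hx : 0 < x
  hx = s≤s z≤n

  open Invariant N G₀ k
  module B = Pipes N G
  module B′ = Pipes N G′
  module Ge = SharedCells N G
  module Ge′ = SharedCells N G′
  module Geo1 = PipeRegions N G
  open DroopTiles G G′ a b x hx hdt
  open B using (src)

  pN : p < N
  pN = proj₁ kp

  exits-G : ExitsPreserved G
  exits-G = proj₁ core

  InRect? : ∀ i j → Dec (InRect i j)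
  InRect? i j = a ≤? i ×-dec i ≤? a + x ×-dec (j ≟ b ⊎-dec j ≟ suc b)

  axN : a + x ≤ N ∸ 1
  axN = <⇒≤pred hax

  pS : ∀ t → t < x → B.Path (src p) (a + t , b , fromS)
  pS zero _ = subst (λ i → B.Path (src p) (i , b , fromS)) (sym (+-identityʳ a)) pa
  pS (suc t) lt with Ge.pred-S (pS t (<-trans (n<1+n t) lt)) (subst (_≤ N ∸ 1) (+-suc a t) (≤-trans (+-monoʳ-≤ a (<⇒≤ lt)) axN))
  ... | d , q , e with proj₁ (T-mid (suc t) (s≤s z≤n) lt)
  ...   | gc = subst (λ i → B.Path (src p) (i , b , fromS)) (sym (+-suc a t)) (subst (λ d → B.Path (src p) (suc (a + t) , b , d)) (dS d (trans (cong (λ i → route (G i b) d) (+-suc a t)) e)) q)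
    where
    dS : ∀ d → route (G (a + suc t) b) d ≡ just toN → d ≡ fromS
    dS fromS _ = refl
    dS fromW e′ rewrite gc = case e′ of λ ()

  pX : Σ In λ d₀ → B.Path (src p) (a + x , b , d₀) × route (G (a + x) b) d₀ ≡ just toN
  pX with Ge.pred-S (pS x′ (n<1+n x′)) (subst (_≤ N ∸ 1) (+-suc a x′) axN)
  ... | d , q , e = d , subst (λ i → B.Path (src p) (i , b , d)) (sym (+-suc a x′)) q , subst (λ i → route (G i b) d ≡ just toN) (sym (+-suc a x′)) e

  d₀ : In
  d₀ = proj₁ pX

  p-ab-E : route (G a b) fromS ≡ just toE
  p-ab-E with T-ab
  ... | inj₁ (e , _) rewrite e = refl
  ... | inj₂ (e , _) rewrite e = refl

  pB1 : B.Path (src p) (a , suc b , fromW)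
  pB1 = pa B.▸ B.stE p-ab-E hb1

  single-pipe-tile : ∀ t d d′ {o o′} → t ≢ cross → t ≢ bump → route t d ≡ just o → route t d′ ≡ just o′ → d ≡ d′
  single-pipe-tile t fromS fromS _ _ _ _ = refl
  single-pipe-tile t fromW fromW _ _ _ _ = refl
  single-pipe-tile t fromS fromW nc nb e e′ with Ge.two-sides t e e′
  ... | inj₁ q = ⊥-elim (nc q)
  ... | inj₂ q = ⊥-elim (nb q)
  single-pipe-tile t fromW fromS nc nb e e′ with Ge.two-sides t e′ e
  ... | inj₁ q = ⊥-elim (nc q)
  ... | inj₂ q = ⊥-elim (nb q)

  onroute : ∀ c → c < N → ∀ {z} → B.Path (src c) z → Σ Out λ o → routeAt G z ≡ just o
  onroute c cN pc = Geo1.OfPipe.on-route c cN (proj₂ (proj₂ (exits-G c cN))) pc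

  nocontra : ∀ {A : Set} {t d} → route t d ≡ nothing → Σ Out (λ o → route t d ≡ just o) → A
  nocontra e (o , e′) = case trans (sym e) e′ of λ ()

  other-pipes-unchanged : ∀ c → c < N → c ≢ p → ∀ z → B.Path (src c) z → routeAt G′ z ≡ routeAt G z
  other-pipes-unchanged c cN ne (i , j , d) pc with InRect? i j
  ... | no nr = cong (λ t → route t d) (T-out i j nr)
  ... | yes r = go (classify r) d pc
    where
    go : ∀ {i j} → RectCell i j → ∀ d → B.Path (src c) (i , j , d) → route (G′ i j) d ≡ route (G i j) d
    go rAB fromS pc = ⊥-elim (ne (B.pipe-inj pc pa))
    go rAB fromW pc with T-ab | onroute c cN pc
    ... | inj₁ (g , g′) | orr rewrite g = nocontra {t = rel} {d = fromW} refl orr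
    ... | inj₂ (g , g′) | orr rewrite g | g′ = refl
    go (rMid t h0 h1) fromS pc = ⊥-elim (ne (B.pipe-inj pc (pS t h1)))
    go (rMid t h0 h1) fromW pc with T-mid t h0 h1
    ... | g , g′ rewrite g | g′ = refl
    go rAXB d pc with pX | onroute c cN pc
    ... | (dd , q , e) | (o , eo) with single-pipe-tile (G (a + x) b) d dd ntc ntb eo e
      where
      ntc : G (a + x) b ≢ cross
      ntc eq with T-axb
      ... | inj₁ (g , _) = case trans (sym g) eq of λ ()
      ... | inj₂ (g , _) = case trans (sym g) eq of λ ()
      ntb : G (a + x) b ≢ bump
      ntb eq with T-axb
      ... | inj₁ (g , _) = case trans (sym g) eq of λ ()
      ... | inj₂ (g , _) = case trans (sym g) eq of λ ()
    ... | refl = ⊥-elim (ne (B.pipe-inj pc q))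
    go rAXB1 d pc with T-axb1 | onroute c cN pc
    ... | inj₁ (g , g′) | orr rewrite g = nocontra {t = blank} {d = d} (blankN d) orr
      where blankN : ∀ d → route blank d ≡ nothing
            blankN fromS = refl
            blankN fromW = refl
    ... | inj₂ (g , g′) | orr rewrite g | g′ = relbump d orr
      where relbump : ∀ d → Σ Out (λ o → route rel d ≡ just o) → route bump d ≡ route rel d
            relbump fromS _ = refl
            relbump fromW orr = nocontra {t = rel} {d = fromW} refl orr
    go (rMid1 t h0 h1) d pc with T-mid1 t h0 h1 | onroute c cN pc
    ... | inj₁ (g , g′) | orr rewrite g | g′ = horcross d orr
      where horcross : ∀ d → Σ Out (λ o → route hor d ≡ just o) → route cross d ≡ route hor d
            horcross fromW _ = refl
            horcross fromS orr = nocontra {t = hor} {d = fromS} refl orr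
    ... | inj₂ (g , g′) | orr rewrite g = nocontra {t = blank} {d = d} (blankN d) orr
      where blankN : ∀ d → route blank d ≡ nothing
            blankN fromS = refl
            blankN fromW = refl
    go rAB1 d pc with onroute c cN pc | onroute p pN pB1
    ... | (o , eo) | (o′ , eo′) with single-pipe-tile (G a (suc b)) d fromW ntc ntb eo eo′
      where
      ntc : G a (suc b) ≢ cross
      ntc eq with T-ab1
      ... | inj₁ (g , _) = case trans (sym g) eq of λ ()
      ... | inj₂ (g , _) = case trans (sym g) eq of λ ()
      ntb : G a (suc b) ≢ bump
      ntb eq with T-ab1
      ... | inj₁ (g , _) = case trans (sym g) eq of λ ()
      ... | inj₂ (g , _) = case trans (sym g) eq of λ ()
    ... | refl = ⊥-elim (ne (B.pipe-inj pc pB1))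

  module RectPosition (H : Grid) where
    module C = Pipes N H
    before-out : ∀ {i j d w e} → C.Step (i , j , d) w → C.Fwd w (a + x , b , e) → ¬ InRect i j
    before-out s f (l1 , l2 , ej) with C.fwd-strict s f | C.fwd-mono (s C.∷ f)
    ... | inj₁ lt | r1 , c1 = <-irrefl refl (<-≤-trans lt l2)
    ... | inj₂ lt | r1 , c1 with ej
    ...   | inj₁ refl = <-irrefl refl lt
    ...   | inj₂ refl = <-irrefl refl (<-≤-trans (n<1+n _) c1)

    after-out : ∀ {d w z} → C.Step (a , suc b , d) w → C.Fwd w z → ¬ InRect (C.row z) (C.col z)
    after-out s f (l1 , l2 , ej) with C.step-mono s | C.fwd-mono f
    ... | inj₁ (lt , ceq) | r1 , c1 = <-irrefl refl (≤-<-trans (≤-trans l1 r1) lt)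
    ... | inj₂ (req , lt) | r1 , c1 with ej
    ...   | inj₁ refl = <-irrefl refl (<-trans (n<1+n _) (<-≤-trans lt c1))
    ...   | inj₂ refl = <-irrefl refl (<-≤-trans lt c1)

    between-in : ∀ {y dm de} → C.Fwd (a + x , b , dm) y → C.Fwd y (a , suc b , de) → InRect (C.row y) (C.col y)
    between-in f g with C.fwd-mono f | C.fwd-mono g
    ... | r1 , c1 | r2 , c2 with m≤n⇒m<n∨m≡n c1
    ...   | inj₂ e = r2 , r1 , inj₁ (sym e)
    ...   | inj₁ l = r2 , r1 , inj₂ (≤-antisym c2 l)

  module PathOutsideRect (H₁ H₂ : Grid) (hout : ∀ i j → ¬ InRect i j → H₂ i j ≡ H₁ i j) (dm dF dT : In)
    (pm : Pipes.Path N H₁ (src p) (a + x , b , dm)) (pe : Pipes.Path N H₁ (src p) (a , suc b , dF))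
    (pe′ : Pipes.Path N H₂ (src p) (a , suc b , dT))
    (re : route (H₂ a (suc b)) dT ≡ route (H₁ a (suc b)) dF) where
    module C₁ = Pipes N H₁
    module C₂ = Pipes N H₂
    module T = RouteTransfer N H₁ H₂
    open RectPosition H₁

    routeOut : ∀ {z} → ¬ InRect (C₁.row z) (C₁.col z) → routeAt H₂ z ≡ routeAt H₁ z
    routeOut {i , j , d} nr = cong (λ t → route t d) (hout i j nr)

    path-outside-rect : ∀ {y} → C₁.Path (src p) y → ¬ InRect (C₁.row y) (C₁.col y) → C₂.Path (src p) y
    path-outside-rect {y} py nr with C₁.cmp (C₁.toFwd py) (C₁.toFwd pm)
    ... | inj₁ f = T.transfer-prefix py (λ {z} {w} pz s fw → routeOut {z} (before-out s (fw C₁.++ᶠ f)))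
    ... | inj₂ f with C₁.cmp (C₁.toFwd py) (C₁.toFwd pe)
    ...   | inj₁ g = ⊥-elim (nr (between-in f g))
    ...   | inj₂ C₁.[] = ⊥-elim (nr (≤-refl , m≤m+n a x , inj₂ refl))
    ...   | inj₂ (s C₁.∷ g) = (pe′ C₂.▸ T.transfer-step-side re s) C₂.++ᵖ C₂.toPath (T.transfer-fwd g (λ {z} {w} fz sz fw → routeOut {z} (after-out s fz)))

  open RectPosition G using (before-out; after-out)

  routeOutG : ∀ {z} → ¬ InRect (B.row z) (B.col z) → routeAt G′ z ≡ routeAt G z
  routeOutG {i , j , d} nr = cong (λ t → route t d) (T-out i j nr)

  prefix-unchanged : B′.Path (src p) (a + x , b , d₀)
  prefix-unchanged = RouteTransfer.transfer-prefix N G G′ (proj₁ (proj₂ pX)) (λ {z} {w} pz s fw → routeOutG {z} (before-out s fw))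

  turn-east-at-bottom : B′.Step (a + x , b , d₀) (a + x , suc b , fromW)
  turn-east-at-bottom = B′.stE (r1 d₀ (proj₂ (proj₂ pX))) hb1
    where
    r1 : ∀ d → route (G (a + x) b) d ≡ just toN → route (G′ (a + x) b) d ≡ just toE
    r1 d e with T-axb
    r1 fromS e | inj₁ (g , g′) rewrite g′ = refl
    r1 fromW e | inj₁ (g , g′) rewrite g with e
    ... | ()
    r1 fromW e | inj₂ (g , g′) rewrite g′ = refl
    r1 fromS e | inj₂ (g , g′) rewrite g with e
    ... | ()

  stN′ : ∀ {i i′ j d} → i ≡ suc i′ → route (G′ i j) d ≡ just toN → B′.Step (i , j , d) (i′ , j , fromS)
  stN′ refl e = B′.stN e

  turn-north-at-corner : B′.Step (a + x , suc b , fromW) (a + x′ , suc b , fromS)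
  turn-north-at-corner = stN′ (+-suc a x′) r2
    where
    r2 : route (G′ (a + x) (suc b)) fromW ≡ just toN
    r2 with T-axb1
    ... | inj₁ (_ , g′) rewrite g′ = refl
    ... | inj₂ (_ , g′) rewrite g′ = refl

  climb-step : ∀ u → suc u < x → B′.Step (a + suc u , suc b , fromS) (a + u , suc b , fromS)
  climb-step u lt = stN′ (+-suc a u) r3
    where
    r3 : route (G′ (a + suc u) (suc b)) fromS ≡ just toN
    r3 with T-mid1 (suc u) (s≤s z≤n) lt
    ... | inj₁ (_ , g′) rewrite g′ = refl
    ... | inj₂ (_ , g′) rewrite g′ = refl

  climb : ∀ t u → t ≤ u → u < x → B′.Path (a + u , suc b , fromS) (a + t , suc b , fromS)
  climb t u le lt with m≤n⇒m<n∨m≡n le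
  ... | inj₂ refl = B′.ε
  climb t (suc u) le lt | inj₁ l = B′.path-cons (climb-step u lt) (climb t u (s≤s⁻¹ l) (<-trans (n<1+n u) lt))

  p′mid : ∀ t → t < x → B′.Path (src p) (a + t , suc b , fromS)
  p′mid t lt = (prefix-unchanged B′.▸ turn-east-at-bottom B′.▸ turn-north-at-corner) B′.++ᵖ climb t x′ (s≤s⁻¹ lt) (n<1+n x′)

  p′ab1 : B′.Path (src p) (a , suc b , fromS)
  p′ab1 = subst (λ i → B′.Path (src p) (i , suc b , fromS)) (+-identityʳ a) (p′mid 0 hx)

  p′axb1 : B′.Path (src p) (a + x , suc b , fromW)
  p′axb1 = prefix-unchanged B′.▸ turn-east-at-bottom

  re : route (G′ a (suc b)) fromS ≡ route (G a (suc b)) fromW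
  re with T-ab1
  ... | inj₁ (g , g′) rewrite g | g′ = refl
  ... | inj₂ (g , g′) rewrite g | g′ = refl

  module CGG′ = PathOutsideRect G G′ T-out d₀ fromW fromS (proj₁ (proj₂ pX)) pB1 p′ab1 re
  module CG′G = PathOutsideRect G′ G (λ i j nr → sym (T-out i j nr)) d₀ fromS fromW prefix-unchanged p′ab1 pB1 (sym re)

  p-path-to-G′ : ∀ {y} → B.Path (src p) y → ¬ InRect (B.row y) (B.col y) → B′.Path (src p) y
  p-path-to-G′ = CGG′.path-outside-rect
  p-path-to-G : ∀ {y} → B′.Path (src p) y → ¬ InRect (B.row y) (B.col y) → B.Path (src p) y
  p-path-to-G = CG′G.path-outside-rect

  p-exits′ : ∀ {r} → B.Exits p r → B′.Exits p r
  p-exits′ (zF , pF , fF) with B.before-final (B.toFwd pB1) (B.toFwd pF) fF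
  ... | B.[] with fF
  ...   | B.fin e nl = (a , suc b , fromS) , p′ab1 , B′.fin (trans re e) nl
  p-exits′ (zF , pF , fF) | s B.∷ g = zF , p-path-to-G′ pF (after-out s g) , RouteTransfer.transfer-final N G G′ (routeOutG {zF} (after-out s g)) fF

  exits-G′ : ExitsPreserved G′
  exits-G′ c cN with c ≟ p
  ... | yes refl with exits-G c cN
  ...   | r , c0 , cg = r , c0 , p-exits′ cg
  exits-G′ c cN | no ne with exits-G c cN
  ...   | r , c0 , cg = r , c0 , RouteTransfer.transfer-exits N G G′ (other-pipes-unchanged c cN ne) cg

  path-to-G : ∀ {c y} → c < N → B′.Path (src c) y → ¬ InRect (B.row y) (B.col y) → B.Path (src c) y
  path-to-G {c} cN q nr with c ≟ p
  ... | yes refl = p-path-to-G q nr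
  ... | no ne = RouteTransfer.transfer-path⁻¹ N G G′ (other-pipes-unchanged c cN ne) q

  path-to-G′ : ∀ {c y} → c < N → B.Path (src c) y → ¬ InRect (B.row y) (B.col y) → B′.Path (src c) y
  path-to-G′ {c} cN q nr with c ≟ p
  ... | yes refl = p-path-to-G′ q nr
  ... | no ne = RouteTransfer.transfer-path N G G′ (other-pipes-unchanged c cN ne) q

  new-cross-in-rect : ∀ {i j} → RectCell i j → G′ i j ≡ cross →
              Σ ℕ λ t → 0 < t × t < x × i ≡ a + t × j ≡ suc b × G i j ≡ hor
  new-cross-in-rect rAB e with T-ab
  ... | inj₁ (_ , g′) = case trans (sym g′) e of λ ()
  ... | inj₂ (_ , g′) = case trans (sym g′) e of λ ()
  new-cross-in-rect rAXB e with T-axb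
  ... | inj₁ (_ , g′) = case trans (sym g′) e of λ ()
  ... | inj₂ (_ , g′) = case trans (sym g′) e of λ ()
  new-cross-in-rect (rMid t h0 h1) e = case trans (sym (proj₂ (T-mid t h0 h1))) e of λ ()
  new-cross-in-rect rAXB1 e with T-axb1
  ... | inj₁ (_ , g′) = case trans (sym g′) e of λ ()
  ... | inj₂ (_ , g′) = case trans (sym g′) e of λ ()
  new-cross-in-rect (rMid1 t h0 h1) e with T-mid1 t h0 h1
  ... | inj₁ (g , _) = t , h0 , h1 , refl , refl , g
  ... | inj₂ (_ , g′) = case trans (sym g′) e of λ ()
  new-cross-in-rect rAB1 e with T-ab1
  ... | inj₁ (_ , g′) = case trans (sym g′) e of λ ()
  ... | inj₂ (_ , g′) = case trans (sym g′) e of λ ()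

  crosses-ordered-G′ : CrossesOrdered G′
  crosses-ordered-G′ i j h e hN ph with InRect? i j
  ... | no nr with proj₂ core i j h (trans (sym (T-out i j nr)) e) hN (path-to-G hN ph nr)
  ...   | v , vN , pv , lt , el = v , vN , path-to-G′ vN pv nr , lt , el
  crosses-ordered-G′ i j h e hN ph | yes r with new-cross-in-rect (classify r) e
  ... | t , h0 , h1 , refl , refl , g with h ≟ p
  ...   | yes refl = case Ge′.same-side ph (p′mid t h1) of λ ()
  ...   | no ne with Ge.pred-W (RouteTransfer.transfer-path⁻¹ N G G′ (other-pipes-unchanged h hN ne) ph)
  ...     | d , q , e2 with proj₁ (T-mid t h0 h1)
  ...       | gc with dW d e2
    where
    dW : ∀ d → route (G (a + t) b) d ≡ just toE → d ≡ fromW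
    dW fromW _ = refl
    dW fromS e3 rewrite gc with e3
    ... | ()
  ...         | refl with proj₂ core (a + t) b h gc hN q
  ...           | v , vN , pv , lt , el with B.pipe-inj pv (pS t h1)
  ...             | refl = p , pN , p′mid t h1 , lt , el

  core′ : Core G′
  core′ = exits-G′ , crosses-ordered-G′

  bumps′ : BumpOnlyAt G′ (a + x) (suc b)
  bumps′ i j e with InRect? i j
  ... | no nr with bumps i j (trans (sym (T-out i j nr)) e)
  ...   | refl , refl = ⊥-elim (nr (≤-refl , m≤m+n a x , inj₁ refl))
  bumps′ i j e | yes r = go (classify r) e
    where
    go : ∀ {i j} → RectCell i j → G′ i j ≡ bump → i ≡ a + x × j ≡ suc b
    go rAXB1 e = refl , refl
    go rAB e with T-ab
    ... | inj₁ (_ , g′) = case trans (sym g′) e of λ ()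
    ... | inj₂ (_ , g′) = case trans (sym g′) e of λ ()
    go rAXB e with T-axb
    ... | inj₁ (_ , g′) = case trans (sym g′) e of λ ()
    ... | inj₂ (_ , g′) = case trans (sym g′) e of λ ()
    go (rMid t h0 h1) e = case trans (sym (proj₂ (T-mid t h0 h1))) e of λ ()
    go (rMid1 t h0 h1) e with T-mid1 t h0 h1
    ... | inj₁ (_ , g′) = case trans (sym g′) e of λ ()
    ... | inj₂ (_ , g′) = case trans (sym g′) e of λ ()
    go rAB1 e with T-ab1
    ... | inj₁ (_ , g′) = case trans (sym g′) e of λ ()
    ... | inj₂ (_ , g′) = case trans (sym g′) e of λ ()

  corner-tile : (G′ (a + x) b ≡ rel × B′.Path (src p) (a + x , b , fromS)) ⊎ (G′ (a + x) b ≡ hor × B′.Path (src p) (a + x , b , fromW))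
  corner-tile with T-axb | d₀ | proj₂ (proj₂ pX) | prefix-unchanged
  ... | inj₁ (g , g′) | fromS | e | q = inj₁ (g′ , q)
  ... | inj₁ (g , g′) | fromW | e | q rewrite g with e
  ...   | ()
  corner-tile | inj₂ (g , g′) | fromW | e | q = inj₂ (g′ , q)
  corner-tile | inj₂ (g , g′) | fromS | e | q rewrite g with e
  ...   | ()

module SwapGeometry (N : ℕ) (G₀ : Grid) (k : ℕ) (mono : Invariant.LabelsIncreasing N G₀ k) (H : Grid)
  (core : Invariant.Core N G₀ k H) (A B p q a′ b′ : ℕ)
  (bumpsH : Invariant.BumpOnlyAt N G₀ k H A B) (kp : Invariant.ExitsAboveK N G₀ k p) (qN : q < N)
  (ppAB : Pipes.Path N H (Pipes.src N H p) (A , B , fromW))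
  (pqAB : Pipes.Path N H (Pipes.src N H q) (A , B , fromS))
  (hAB : H A B ≡ bump) (hZ : H a′ b′ ≡ cross)
  (ppZ′ : Σ In λ d → Pipes.Path N H (Pipes.src N H p) (a′ , b′ , d))
  (pqZ′ : Σ In λ d → Pipes.Path N H (Pipes.src N H q) (a′ , b′ , d)) where

  open Invariant N G₀ k
  open Pipes N H
  module Ge = SharedCells N H
  module Go = PipeRegions N H

  pN : p < N
  pN = proj₁ kp

  exits-of : ∀ r → r < N → Σ ℕ (Exits r)
  exits-of r rN = proj₁ (proj₁ core r rN) , proj₂ (proj₂ (proj₁ core r rN))

  cpP : Σ ℕ (Exits p)
  cpP = exits-of p pN
  cpQ : Σ ℕ (Exits q)
  cpQ = exits-of q qN

  module GP = Go.OfPipe p pN (proj₂ cpP)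
  module GQ = Go.OfPipe q qN (proj₂ cpQ)

  nh : ∀ {i j} → Path (src p) (i , j , fromW) → H i j ≡ cross → ⊥
  nh = no-horizontal-cross mono core kp

  p≢q : p ≢ q
  p≢q e = fromW≢fromS (Ge.same-side ppAB (subst (λ c → Path (src c) (A , B , fromS)) (sym e) pqAB))

  shared-cell : ∀ {u v i j du dv} → u < N → v < N → Path (src u) (i , j , du) → Path (src v) (i , j , dv) → u ≢ v →
       du ≢ dv × (H i j ≡ cross ⊎ (i ≡ A × j ≡ B))
  shared-cell {u} {v} {i} {j} {du} {dv} uN vN pu pv ne = dne , tile
    where
    dne : du ≢ dv
    dne = Ge.diff-pipes pu pv ne
    ou = Go.OfPipe.on-route u uN (proj₂ (exits-of u uN)) pu
    ov = Go.OfPipe.on-route v vN (proj₂ (exits-of v vN)) pv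
    tileOf : ∀ du dv → du ≢ dv → Σ Out (λ o → route (H i j) du ≡ just o) → Σ Out (λ o → route (H i j) dv ≡ just o) → H i j ≡ cross ⊎ H i j ≡ bump
    tileOf fromS fromS ne _ _ = ⊥-elim (ne refl)
    tileOf fromW fromW ne _ _ = ⊥-elim (ne refl)
    tileOf fromS fromW _ (o , e) (o′ , e′) = Ge.two-sides (H i j) e e′
    tileOf fromW fromS _ (o , e) (o′ , e′) = Ge.two-sides (H i j) e′ e
    tile : H i j ≡ cross ⊎ (i ≡ A × j ≡ B)
    tile with tileOf du dv dne ou ov
    ... | inj₁ c = inj₁ c
    ... | inj₂ b = inj₂ (bumpsH i j b)

  dZp : In
  dZp = proj₁ ppZ′
  dZq : In
  dZq = proj₁ pqZ′

  -- p is the vertical pipe at the cross, as it never runs horizontally through one.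
  ppZ : Path (src p) (a′ , b′ , fromS)
  ppZ with dZp | proj₂ ppZ′
  ... | fromS | pp = pp
  ... | fromW | pp = ⊥-elim (nh pp hZ)

  pqZ : Path (src q) (a′ , b′ , fromW)
  pqZ with dZq | proj₂ pqZ′
  ... | fromW | pq = pq
  ... | fromS | pq = ⊥-elim (proj₁ (shared-cell pN qN ppZ pq p≢q) refl)

  bumpSE : route (H A B) fromS ≡ just toE
  bumpSE rewrite hAB = refl
  bumpWN : route (H A B) fromW ≡ just toN
  bumpWN rewrite hAB = refl

  p-cross⇝bump : Fwd (a′ , b′ , fromS) (A , B , fromW)
  p-cross⇝bump with cmp (toFwd ppZ) (toFwd ppAB)
  ... | inj₁ f = f
  ... | inj₂ (s ∷ g) with GQ.shared-leave pqAB fromW≢fromS s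
  ...   | inj₂ (e , _) = case trans (sym bumpSE) e of λ ()
  ...   | inj₁ (_ , ab) with GQ.walk-above (proj₁ (fwd-mono (toFwd (ppAB ▸ s)))) ab g
  ...     | inj₁ ab′ = ⊥-elim (GQ.above-not-on ab′ (_ , pqZ))
  ...     | inj₂ ((i′ , j′ , .fromW) , g1 , g2 , (dq , pq) , refl) with shared-cell pN qN ((ppAB ▸ s) ++ᵖ toPath g1) pq p≢q
  ...       | _ , inj₁ cr = ⊥-elim (nh ((ppAB ▸ s) ++ᵖ toPath g1) cr)
  ...       | _ , inj₂ (refl , refl) = ⊥-elim (step-no-return s g1)

  q-cross⇝bump : Fwd (a′ , b′ , fromW) (A , B , fromS)
  q-cross⇝bump with cmp (toFwd pqZ) (toFwd pqAB)
  ... | inj₁ f = f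
  ... | inj₂ (s ∷ g) with GP.shared-leave ppAB fromS≢fromW s
  ...   | inj₁ (e , _) = case trans (sym e) bumpWN of λ ()
  ...   | inj₂ (_ , bl) with GP.walk-below bl g
  ...     | inj₁ bl′ = ⊥-elim (GP.below-not-on bl′ (_ , ppZ))
  ...     | inj₂ ((i′ , j′ , .fromS) , g1 , g2 , (dp , pp) , refl) with shared-cell pN qN pp ((pqAB ▸ s) ++ᵖ toPath g1) p≢q
  ...       | dne , inj₁ cr = ⊥-elim (dne′ dp pp dne)
    where
    dne′ : ∀ d → Path (src p) (i′ , j′ , d) → d ≢ fromS → ⊥
    dne′ fromS _ ne = ne refl
    dne′ fromW pp′ _ = nh pp′ cr
  ...       | _ , inj₂ (refl , refl) = ⊥-elim (step-no-return s g1)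

  -- The stretches of q and of p strictly between the cross (a′ , b′) and the bump (A , B): the swap
  -- makes p and q exchange them.
  MidQ : Cell → Set
  MidQ y = Fwd (a′ , b′ , fromW) y × Fwd y (A , B , fromS) × y ≢ (a′ , b′ , fromW)

  MidP : Cell → Set
  MidP y = Fwd (a′ , b′ , fromS) y × Fwd y (A , B , fromW) × y ≢ (a′ , b′ , fromS)

  midQ-below : ∀ {y} → MidQ y → y ≢ (A , B , fromS) → Go.Below p (row y) (col y)
  midQ-below ([] , g , ne) ne′ = ⊥-elim (ne refl)
  midQ-below {y} (s ∷ f , g , ne) ne′ with GP.shared-leave ppZ fromW≢fromS s
  ... | inj₁ (e , _) = case trans (sym (cong (λ t → route t fromS) hZ)) e of λ ()
  ... | inj₂ (_ , bl) with GP.walk-below bl f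
  ...   | inj₁ bl′ = bl′
  ...   | inj₂ ((i′ , j′ , .fromS) , g1 , g2 , (dp , pp) , refl) with shared-cell pN qN pp ((pqZ ▸ s) ++ᵖ toPath g1) p≢q
  ...     | dne , inj₁ cr = ⊥-elim (dne′ dp pp dne)
    where
    dne′ : ∀ d → Path (src p) (i′ , j′ , d) → d ≢ fromS → ⊥
    dne′ fromS _ ne = ne refl
    dne′ fromW pp′ _ = nh pp′ cr
  ...     | _ , inj₂ (refl , refl) = ⊥-elim (ne′ (fwd-antisym g (g2 ++ᶠ [])))

  midP-above : ∀ {y} → MidP y → y ≢ (A , B , fromW) → Go.Above q (row y) (col y)
  midP-above ([] , g , ne) ne′ = ⊥-elim (ne refl)
  midP-above {y} (s ∷ f , g , ne) ne′ with GQ.shared-leave pqZ fromS≢fromW s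
  ... | inj₂ (e , _) = case trans (sym (cong (λ t → route t fromW) hZ)) e of λ ()
  ... | inj₁ (_ , ab) with GQ.walk-above (proj₁ (fwd-mono (toFwd (ppZ ▸ s)))) ab f
  ...   | inj₁ ab′ = ab′
  ...   | inj₂ ((i′ , j′ , .fromW) , g1 , g2 , (dq , pq) , refl) with shared-cell pN qN ((ppZ ▸ s) ++ᵖ toPath g1) pq p≢q
  ...     | _ , inj₁ cr = ⊥-elim (nh ((ppZ ▸ s) ++ᵖ toPath g1) cr)
  ...     | _ , inj₂ (refl , refl) = ⊥-elim (ne′ (fwd-antisym g (g2 ++ᶠ [])))

  BN : B < N
  BN = Go.path-colN qN pqAB

  not-between-at-B : ∀ {i} → Go.Below p i B → Go.Above q i B → ⊥
  not-between-at-B (b0 , bt , lt) ab with GP.bot-unique bt (inj₂ ppAB)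
  ... | refl with ab
  ...   | inj₁ lt2 = <-irrefl refl (<-≤-trans lt2 (Go.path-colc pqAB))
  ...   | inj₂ (t , tp , lt2) with GQ.top-unique tp (fromS , pqAB , bumpSE)
  ...     | refl = <-asym lt lt2

  walk-between : ∀ {y z rr} → row y ≤ N ∸ 1 → Final z rr → Fwd y z → Go.Below p (row y) (col y) → Go.Above q (row y) (col y) → col y ≤ B →
             Σ Cell λ w → Fwd y w × ((Go.On p (row w) (col w) × GP.side w ≡ fromS) ⊎ (Go.On q (row w) (col w) × GP.side w ≡ fromW))
  walk-between {i , j , d} rn (fin e nl) [] bl ab le with m≤n⇒m<n∨m≡n le
  ... | inj₂ refl = ⊥-elim (not-between-at-B bl ab)
  ... | inj₁ lt = ⊥-elim (nl (≤-<-trans lt BN))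
  walk-between {i , j , d} rn fz (s ∷ f) bl ab le with GP.below-step bl s
  ... | inj₂ (on , e) = _ , s ∷ [] , inj₁ (on , e)
  ... | inj₁ bl′ with GQ.above-step rn ab s
  ...   | inj₂ (on , e) = _ , s ∷ [] , inj₂ (on , e)
  ...   | inj₁ ab′ with j ≟ B
  ...     | yes refl = ⊥-elim (not-between-at-B bl ab)
  ...     | no ne with walk-between (≤-trans (proj₁ (fwd-mono (s ∷ []))) rn) fz f bl′ ab′ (colle s (≤∧≢⇒< le ne))
    where
    colle : ∀ {w} → Step (i , j , d) w → j < B → col w ≤ B
    colle (stN _) l = <⇒≤ l
    colle (stE _ _) l = l
  ...       | w , g , r = w , s ∷ g , r

  module Meets (r : ℕ) (rN : r < N) (r≢p : r ≢ p) (r≢q : r ≢ q) where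
    hitP-S : ∀ {i j} → Path (src r) (i , j , fromS) → Go.On p i j → ⊥
    hitP-S {i} {j} pr (dp , pp) with shared-cell rN pN pr pp r≢p
    ... | dne , inj₁ cr = go dp pp dne
      where
      go : ∀ d → Path (src p) (i , j , d) → fromS ≢ d → ⊥
      go fromS _ ne = ne refl
      go fromW pp′ _ = nh pp′ cr
    ... | dne , inj₂ (refl , refl) = r≢q (pipe-inj pr pqAB)

    hitQ-W : ∀ {i j} → Path (src r) (i , j , fromW) → Go.On q i j → r < q × ExitsAbove q r
    hitQ-W {i} {j} pr (dq , pq) with shared-cell rN qN pr pq r≢q
    ... | dne , inj₂ (refl , refl) = ⊥-elim (r≢p (pipe-inj pr ppAB))
    ... | dne , inj₁ cr with proj₂ core i j r cr rN pr
    ...   | v , vN , pv , lt , el = go dq pq dne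
      where
      go : ∀ d → Path (src q) (i , j , d) → fromW ≢ d → r < q × ExitsAbove q r
      go fromW _ ne = ⊥-elim (ne refl)
      go fromS pq′ _ with pipe-inj pv pq′
      ... | refl = lt , el

  midQ-cross-impossible : ∀ {i j r} → H i j ≡ cross → r < N → Path (src r) (i , j , fromS) → MidQ (i , j , fromW) → q < r → ⊥
  midQ-cross-impossible {i} {j} {r} cr rN pr mq@(f1 , f2 , ne) q<r = body
    where
    bl : Go.Below p i j
    bl = midQ-below mq (λ ())
    pqY : Path (src q) (i , j , fromW)
    pqY = pqZ ++ᵖ toPath f1
    r≢q : r ≢ q
    r≢q e = fromS≢fromW (Ge.same-side pr (subst (λ c → Path (src c) (i , j , fromW)) (sym e) pqY))
    r≢p : r ≢ p
    r≢p e = GP.below-not-on bl (fromS , subst (λ c → Path (src c) (i , j , fromS)) e pr)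
    open Meets r rN r≢p r≢q
    module GR = Go.OfPipe r rN (proj₂ (exits-of r rN))
    body : ⊥
    body with GR.zF | GR.on-before pr | GR.fF
    ... | z | [] | fin e _ rewrite cr with e
    ...   | ()
    body | z | s ∷ f | fz with GQ.shared-leave pqY fromS≢fromW s
    ... | inj₂ (e , _) rewrite cr with e
    ...   | ()
    body | z | s ∷ f | fz | inj₁ (_ , ab) with GP.below-step bl s
    ...   | inj₂ (on , e) = hs s on e
      where
      hs : ∀ {w} → Step (i , j , fromS) w → Go.On p (row w) (col w) → GP.side w ≡ fromS → ⊥
      hs {i′ , j′ , .fromS} s′ on′ refl = hitP-S (pr ▸ s′) on′
    ...   | inj₁ bl′ with walk-between (proj₁ (fwd-mono (toFwd (pr ▸ s)))) fz f bl′ ab (colY s)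
      where
      colY : ∀ {w} → Step (i , j , fromS) w → col w ≤ B
      colY (stN _) = proj₂ (fwd-mono f2)
      colY (stE e _) = ⊥-elim (crS e)
        where
        crS : route (H i j) fromS ≡ just toE → ⊥
        crS e′ rewrite cr with e′
        ... | ()
    ...     | (i′ , j′ , d′) , g , inj₁ (on , refl) = hitP-S (pr ++ᵖ toPath (s ∷ g)) on
    ...     | (i′ , j′ , d′) , g , inj₂ (on , refl) = <-asym q<r (proj₁ (hitQ-W (pr ++ᵖ toPath (s ∷ g)) on))

  col-before-bump′ : ∀ {i j i′ B′} → Path (i , j , fromS) (i′ , B′ , fromW) → suc j ≤ B′
  col-before-bump′ (p′ ▸ stE _ _) = s≤s (proj₂ (path-mono p′))

  col-before-bump : ∀ {i j} → Fwd (i , j , fromS) (A , B , fromW) → suc j ≤ B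
  col-before-bump f = col-before-bump′ (toPath f)

  midP-cross-ordered : ∀ {i j r} → H i j ≡ cross → r < N → Path (src r) (i , j , fromW) → MidP (i , j , fromS) → r < q × ExitsAbove q r
  midP-cross-ordered {i} {j} {r} cr rN pr mp@(f1 , f2 , ne) = body
    where
    ab : Go.Above q i j
    ab = midP-above mp (λ ())
    ppY : Path (src p) (i , j , fromS)
    ppY = ppZ ++ᵖ toPath f1
    r≢p : r ≢ p
    r≢p e = fromW≢fromS (Ge.same-side pr (subst (λ c → Path (src c) (i , j , fromS)) (sym e) ppY))
    r≢q : r ≢ q
    r≢q e = GQ.above-not-on ab (fromW , subst (λ c → Path (src c) (i , j , fromW)) e pr)
    open Meets r rN r≢p r≢q
    module GR = Go.OfPipe r rN (proj₂ (exits-of r rN))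
    crWE : route (H i j) fromW ≡ just toE
    crWE rewrite cr = refl
    s : Step (i , j , fromW) (i , suc j , fromW)
    s = stE crWE (≤-<-trans (col-before-bump f2) BN)
    body : r < q × ExitsAbove q r
    body with GP.shared-leave ppY fromW≢fromS s
    ... | inj₁ (e , _) rewrite cr with e
    ...   | ()
    body | inj₂ (_ , bl) with GQ.above-step (proj₁ (path-mono pr)) ab s
    ...   | inj₂ (on , refl) = hitQ-W (pr ▸ s) on
    ...   | inj₁ ab′ with GR.zF | GR.on-before (pr ▸ s) | GR.fF
    ...     | z | f | fz with walk-between (proj₁ (fwd-mono (toFwd (pr ▸ s)))) fz f bl ab′ (col-before-bump f2)
    ...       | (i′ , j′ , d′) , g , inj₁ (on , refl) = ⊥-elim (hitP-S ((pr ▸ s) ++ᵖ toPath g) on)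
    ...       | (i′ , j′ , d′) , g , inj₂ (on , refl) = hitQ-W ((pr ▸ s) ++ᵖ toPath g) on

swapCB-bump-cell : ∀ H A B a′ b′ → swapCB H A B a′ b′ A B ≡ cross
swapCB-bump-cell H A B a′ b′ rewrite ≡ᵇ-true {A} refl | ≡ᵇ-true {B} refl = refl

swapCB-cross-cell : ∀ H A B a′ b′ → ¬ (a′ ≡ A × b′ ≡ B) → swapCB H A B a′ b′ a′ b′ ≡ bump
swapCB-cross-cell H A B a′ b′ ne with a′ ≟ A
... | no n1 rewrite ≡ᵇ-false {a′} {A} n1 | ≡ᵇ-true {a′} refl | ≡ᵇ-true {b′} refl = refl
... | yes e1 rewrite ≡ᵇ-true e1 | ≡ᵇ-false {b′} {B} (λ e2 → ne (e1 , e2)) | ≡ᵇ-true {a′} refl | ≡ᵇ-true {b′} refl = refl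

swapCB-elsewhere : ∀ H A B a′ b′ i j → ¬ (i ≡ A × j ≡ B) → ¬ (i ≡ a′ × j ≡ b′) → swapCB H A B a′ b′ i j ≡ H i j
swapCB-elsewhere H A B a′ b′ i j n1 n2 = trans (cong (λ b → if′ b) (f1 i j n1)) (cong (λ b → if″ b) (f1′ i j n2))
  where
  if′ : Bool → Tile
  if′ b = if b then cross else (if (i ≡ᵇ a′) ∧ (j ≡ᵇ b′) then bump else H i j)
  if″ : Bool → Tile
  if″ b = if b then bump else H i j
  f0 : ∀ m n u v → ¬ (m ≡ u × n ≡ v) → ((m ≡ᵇ u) ∧ (n ≡ᵇ v)) ≡ false
  f0 m n u v ne with m ≟ u
  ... | no n′ rewrite ≡ᵇ-false {m} {u} n′ = refl
  ... | yes e rewrite ≡ᵇ-true e | ≡ᵇ-false {n} {v} (λ e2 → ne (e , e2)) = refl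
  f1 : ∀ i j → ¬ (i ≡ A × j ≡ B) → ((i ≡ᵇ A) ∧ (j ≡ᵇ B)) ≡ false
  f1 i j = f0 i j A B
  f1′ : ∀ i j → ¬ (i ≡ a′ × j ≡ b′) → ((i ≡ᵇ a′) ∧ (j ≡ᵇ b′)) ≡ false
  f1′ i j = f0 i j a′ b′

module SwapStep (N : ℕ) (G₀ : Grid) (k : ℕ) (mono : Invariant.LabelsIncreasing N G₀ k) (H : Grid)
  (core : Invariant.Core N G₀ k H) (A B p q a′ b′ : ℕ)
  (bumpsH : Invariant.BumpOnlyAt N G₀ k H A B) (kp : Invariant.ExitsAboveK N G₀ k p) (qN : q < N)
  (ppAB : Pipes.Path N H (Pipes.src N H p) (A , B , fromW))
  (pqAB : Pipes.Path N H (Pipes.src N H q) (A , B , fromS))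
  (hAB : H A B ≡ bump) (hZ : H a′ b′ ≡ cross)
  (ppZ′ : Σ In λ d → Pipes.Path N H (Pipes.src N H p) (a′ , b′ , d))
  (pqZ′ : Σ In λ d → Pipes.Path N H (Pipes.src N H q) (a′ , b′ , d)) where

  open SwapGeometry N G₀ k mono H core A B p q a′ b′ bumpsH kp qN ppAB pqAB hAB hZ ppZ′ pqZ′ public
  open Invariant N G₀ k
  open Pipes N H

  H″ : Grid
  H″ = swapCB H A B a′ b′

  module B″ = Pipes N H″
  module T = RouteTransfer N H H″
  module T′ = RouteTransfer N H″ H

  Z≢AB : ¬ (a′ ≡ A × b′ ≡ B)
  Z≢AB (refl , refl) = case trans (sym hZ) hAB of λ ()

  ZleAB : A ≤ a′ × b′ ≤ B
  ZleAB = fwd-mono p-cross⇝bump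

  NotS2 : Cell → Set
  NotS2 z = ¬ (row z ≡ A × col z ≡ B) × ¬ (row z ≡ a′ × col z ≡ b′)

  rEq : ∀ {z} → NotS2 z → routeAt H″ z ≡ routeAt H z
  rEq {i , j , d} (n1 , n2) = cong (λ t → route t d) (swapCB-elsewhere H A B a′ b′ i j n1 n2)

  h″AB : H″ A B ≡ cross
  h″AB = swapCB-bump-cell H A B a′ b′
  h″Z : H″ a′ b′ ≡ bump
  h″Z = swapCB-cross-cell H A B a′ b′ Z≢AB

  module WalkOrder (X : Grid) where
    module C = Pipes N X
    bZ-notAB : ∀ {z d} → C.Fwd z (a′ , b′ , d) → ¬ (row z ≡ A × col z ≡ B)
    bZ-notAB f (refl , refl) with C.fwd-mono f
    ... | r1 , c1 = Z≢AB (≤-antisym r1 (proj₁ ZleAB) , ≤-antisym (proj₂ ZleAB) c1)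
    aAB-notZ : ∀ {z d} → C.Fwd (A , B , d) z → ¬ (row z ≡ a′ × col z ≡ b′)
    aAB-notZ {i , j , _} f (refl , refl) with C.fwd-mono f
    ... | r1 , c1 = Z≢AB (≤-antisym r1 (proj₁ ZleAB) , ≤-antisym (proj₂ ZleAB) c1)
    strictA : ∀ {u w z} → C.Step u w → C.Fwd w z → ¬ (row z ≡ row u × col z ≡ col u)
    strictA s f (e1 , e2) with C.fwd-strict s f
    ... | inj₁ lt = <-irrefl e1 lt
    ... | inj₂ lt = <-irrefl (sym e2) lt
    strictB : ∀ {z w u} → C.Step z w → C.Fwd w u → ¬ (row z ≡ row u × col z ≡ col u)
    strictB s f (e1 , e2) with C.fwd-strict s f
    ... | inj₁ lt = <-irrefl (sym e1) lt
    ... | inj₂ lt = <-irrefl e2 lt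

  module OH = WalkOrder H
  module OH″ = WalkOrder H″

  decomp : ∀ {i j d i′ j′ d′} → Fwd (i , j , d) (i′ , j′ , d′) → d ≢ d′ → Σ Cell λ w → Step (i , j , d) w × Fwd w (i′ , j′ , d′)
  decomp [] ne = ⊥-elim (ne refl)
  decomp (s ∷ f) _ = _ , s , f

  decompN : ∀ {y z r} → Fwd y z → Final z r → routeAt H y ≡ just toN → Σ Cell λ w → Step y w × Fwd w z
  decompN [] (fin e _) e′ with trans (sym e) e′
  ... | ()
  decompN (s ∷ f) _ _ = _ , s , f

  wp1 : Cell
  wp1 = proj₁ (decomp p-cross⇝bump fromS≢fromW)
  sp : Step (a′ , b′ , fromS) wp1
  sp = proj₁ (proj₂ (decomp p-cross⇝bump fromS≢fromW))
  gp : Fwd wp1 (A , B , fromW)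
  gp = proj₂ (proj₂ (decomp p-cross⇝bump fromS≢fromW))

  wq : Cell
  wq = proj₁ (decomp q-cross⇝bump fromW≢fromS)
  sq : Step (a′ , b′ , fromW) wq
  sq = proj₁ (proj₂ (decomp q-cross⇝bump fromW≢fromS))
  gq : Fwd wq (A , B , fromS)
  gq = proj₂ (proj₂ (decomp q-cross⇝bump fromW≢fromS))

  rP : ℕ
  rP = proj₁ cpP
  zP : Cell
  zP = GP.zF
  wp : Cell
  wp = proj₁ (decompN (GP.on-before ppAB) GP.fF bumpWN)
  sp2 : Step (A , B , fromW) wp
  sp2 = proj₁ (proj₂ (decompN (GP.on-before ppAB) GP.fF bumpWN))
  gp2 : Fwd wp zP
  gp2 = proj₂ (proj₂ (decompN (GP.on-before ppAB) GP.fF bumpWN))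

  pre″ : B″.Path (src p) (a′ , b′ , fromS)
  pre″ = T.transfer-prefix ppZ (λ {z} pz s fw → rEq {z} (OH.bZ-notAB (s ∷ fw) , OH.strictB s fw))

  stepZ″ : B″.Step (a′ , b′ , fromS) wq
  stepZ″ = T.transfer-step-side eq sq
    where
    eq : route (H″ a′ b′) fromS ≡ route (H a′ b′) fromW
    eq rewrite h″Z | hZ = refl

  midq″ : B″.Fwd wq (A , B , fromS)
  midq″ = T.transfer-fwd gq (λ {z} fz s fw → rEq {z} (OH.strictB s fw , OH.strictA sq fz))

  stepAB″ : B″.Step (A , B , fromS) wp
  stepAB″ = T.transfer-step-side eq sp2
    where
    eq : route (H″ A B) fromS ≡ route (H A B) fromW
    eq rewrite h″AB | hAB = refl

  sufp″ : B″.Fwd wp zP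
  sufp″ = T.transfer-fwd gp2 (λ {z} fz s fw → rEq {z} (OH.strictA sp2 fz , OH.aAB-notZ (sp2 ∷ fz)))

  p″AB : B″.Path (src p) (A , B , fromS)
  p″AB = (pre″ B″.▸ stepZ″) B″.++ᵖ B″.toPath midq″

  p-exits″ : B″.Exits p rP
  p-exits″ = zP , (p″AB B″.▸ stepAB″) B″.++ᵖ B″.toPath sufp″ , T.transfer-final (rEq {zP} (OH.strictA sp2 gp2 , OH.aAB-notZ (sp2 ∷ gp2))) GP.fF

  rQ : ℕ
  rQ = proj₁ cpQ

  preq″ : B″.Path (src q) (a′ , b′ , fromW)
  preq″ = T.transfer-prefix pqZ (λ {z} pz s fw → rEq {z} (OH.bZ-notAB (s ∷ fw) , OH.strictB s fw))

  stepZq″ : B″.Step (a′ , b′ , fromW) wp1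
  stepZq″ = T.transfer-step-side eq sp
    where
    eq : route (H″ a′ b′) fromW ≡ route (H a′ b′) fromS
    eq rewrite h″Z | hZ = refl

  midp″ : B″.Fwd wp1 (A , B , fromW)
  midp″ = T.transfer-fwd gp (λ {z} fz s fw → rEq {z} (OH.strictB s fw , OH.strictA sp fz))

  q″AB : B″.Path (src q) (A , B , fromW)
  q″AB = (preq″ B″.▸ stepZq″) B″.++ᵖ B″.toPath midp″

  eqAB : route (H″ A B) fromW ≡ route (H A B) fromS
  eqAB rewrite h″AB | hAB = refl

  q-exits″ : B″.Exits q rQ
  q-exits″ with GQ.zF | GQ.on-before pqAB | GQ.fF
  ... | z | [] | fin e nl = (A , B , fromW) , q″AB , B″.fin (trans eqAB e) nl
  ... | z | s ∷ g | fz = z , (q″AB B″.▸ T.transfer-step-side eqAB s) B″.++ᵖ B″.toPath (T.transfer-fwd g (λ {z′} fz′ s′ fw → rEq {z′} (OH.strictA s fz′ , OH.aAB-notZ (s ∷ fz′))))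
                        , T.transfer-final (rEq {z} (OH.strictA s g , OH.aAB-notZ (s ∷ g))) fz

  notS2-other : ∀ {c z} → c ≢ p → c ≢ q → Path (src c) z → NotS2 z
  notS2-other {c} {i , j , d} np nq pc = n1 d pc , n2 d pc
    where
    n1 : ∀ d → Path (src c) (i , j , d) → ¬ (i ≡ A × j ≡ B)
    n1 fromS pc′ (refl , refl) = nq (pipe-inj pc′ pqAB)
    n1 fromW pc′ (refl , refl) = np (pipe-inj pc′ ppAB)
    n2 : ∀ d → Path (src c) (i , j , d) → ¬ (i ≡ a′ × j ≡ b′)
    n2 fromS pc′ (refl , refl) = np (pipe-inj pc′ ppZ)
    n2 fromW pc′ (refl , refl) = nq (pipe-inj pc′ pqZ)

  midP-p : ∀ {y} → MidP y → Path (src p) y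
  midP-p (f , _ , _) = ppZ ++ᵖ toPath f
  midQ-q : ∀ {y} → MidQ y → Path (src q) y
  midQ-q (f , _ , _) = pqZ ++ᵖ toPath f

  notMidQ-p : ∀ {y} → Path (src p) y → ¬ MidQ y
  notMidQ-p py m = p≢q (pipe-inj py (midQ-q m))
  notMidP-q : ∀ {y} → Path (src q) y → ¬ MidP y
  notMidP-q py m = p≢q (pipe-inj (midP-p m) py)

  own-other : ∀ {c y} → c ≢ p → c ≢ q → Path (src c) y → B″.Path (src c) y × ¬ MidP y × ¬ MidQ y
  own-other {c} np nq py = T.transfer-path (λ z pz → rEq {z} (notS2-other np nq pz)) py
    , (λ m → np (pipe-inj py (midP-p m))) , (λ m → nq (pipe-inj py (midQ-q m)))

  own-other″ : ∀ {c y} → c ≢ p → c ≢ q → B″.Path (src c) y → Path (src c) y × ¬ MidP y × ¬ MidQ y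
  own-other″ {c} np nq py with T.transfer-path⁻¹ (λ z pz → rEq {z} (notS2-other np nq pz)) py
  ... | py′ = py′ , (λ m → np (pipe-inj py′ (midP-p m))) , (λ m → nq (pipe-inj py′ (midQ-q m)))

  own-p : ∀ {y} → Path (src p) y → NotS2 y → (B″.Path (src p) y × ¬ MidP y × ¬ MidQ y) ⊎ (MidP y × B″.Path (src q) y)
  own-p {y} py (nAB , nZ) with cmp (toFwd py) (toFwd ppZ)
  ... | inj₁ f = inj₁ (T.transfer-prefix py (λ {z} pz s fw → rEq {z} (OH.bZ-notAB (s ∷ (fw ++ᶠ f)) , OH.strictB s (fw ++ᶠ f)))
                      , (λ { (g1 , _ , ne) → ne (fwd-antisym f g1) }) , notMidQ-p py)
  ... | inj₂ [] = ⊥-elim (nZ (refl , refl))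
  ... | inj₂ (s ∷ f) with step-det s sp
  ...   | refl with cmp (toFwd py) (toFwd ppAB)
  ...     | inj₁ g = inj₂ ((s ∷ f , g , λ e → nZ (cong row e , cong col e))
                      , (preq″ B″.▸ stepZq″) B″.++ᵖ B″.toPath (T.transfer-fwd f (λ {z} fz s′ fw → rEq {z} (OH.strictB s′ (fw ++ᶠ g) , OH.strictA sp fz))))
  ...     | inj₂ [] = ⊥-elim (nAB (refl , refl))
  ...     | inj₂ (s₂ ∷ f₂) with step-det s₂ sp2
  ...       | refl = inj₁ ((p″AB B″.▸ stepAB″) B″.++ᵖ B″.toPath (T.transfer-fwd f₂ (λ {z} fz s′ fw → rEq {z} (OH.strictA sp2 fz , OH.aAB-notZ (sp2 ∷ fz))))
                      , (λ { (_ , g , _) → nAB (cong row (fwd-antisym g (s₂ ∷ f₂)) , cong col (fwd-antisym g (s₂ ∷ f₂))) }) , notMidQ-p py)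

  own-q : ∀ {y} → Path (src q) y → NotS2 y → (B″.Path (src q) y × ¬ MidP y × ¬ MidQ y) ⊎ (MidQ y × B″.Path (src p) y)
  own-q {y} py (nAB , nZ) with cmp (toFwd py) (toFwd pqZ)
  ... | inj₁ f = inj₁ (T.transfer-prefix py (λ {z} pz s fw → rEq {z} (OH.bZ-notAB (s ∷ (fw ++ᶠ f)) , OH.strictB s (fw ++ᶠ f)))
                      , notMidP-q py , (λ { (g1 , _ , ne) → ne (fwd-antisym f g1) }))
  ... | inj₂ [] = ⊥-elim (nZ (refl , refl))
  ... | inj₂ (s ∷ f) with step-det s sq
  ...   | refl with cmp (toFwd py) (toFwd pqAB)
  ...     | inj₁ g = inj₂ ((s ∷ f , g , λ e → nZ (cong row e , cong col e))
                      , (pre″ B″.▸ stepZ″) B″.++ᵖ B″.toPath (T.transfer-fwd f (λ {z} fz s′ fw → rEq {z} (OH.strictB s′ (fw ++ᶠ g) , OH.strictA sq fz))))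
  ...     | inj₂ [] = ⊥-elim (nAB (refl , refl))
  ...     | inj₂ (s₂ ∷ f₂) = inj₁ ((q″AB B″.▸ T.transfer-step-side eqAB s₂) B″.++ᵖ B″.toPath (T.transfer-fwd f₂ (λ {z} fz s′ fw → rEq {z} (OH.strictA s₂ fz , OH.aAB-notZ (s₂ ∷ fz))))
                      , notMidP-q py , (λ { (_ , g , _) → nAB (cong row (fwd-antisym g (s₂ ∷ f₂)) , cong col (fwd-antisym g (s₂ ∷ f₂))) }))

  eqBA : route (H″ A B) fromS ≡ route (H A B) fromW
  eqBA rewrite h″AB | hAB = refl

  rEq′ : ∀ {z} → NotS2 z → routeAt H z ≡ routeAt H″ z
  rEq′ {z} n = sym (rEq {z} n)

  own-p″ : ∀ {y} → B″.Path (src p) y → NotS2 y → (Path (src p) y × ¬ MidP y × ¬ MidQ y) ⊎ MidQ y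
  own-p″ {y} py (nAB , nZ) with B″.cmp (B″.toFwd py) (B″.toFwd pre″)
  ... | inj₁ f with T′.transfer-fwd f (λ {z} fz s fw → rEq′ {z} (OH″.bZ-notAB (s B″.∷ fw) , OH″.strictB s fw))
  ...   | fH with T′.transfer-prefix py (λ {z} pz s fw → rEq′ {z} (OH″.bZ-notAB (s B″.∷ (fw B″.++ᶠ f)) , OH″.strictB s (fw B″.++ᶠ f)))
  ...     | pyH = inj₁ (pyH , (λ { (g1 , _ , ne) → ne (fwd-antisym fH g1) }) , notMidQ-p pyH)
  own-p″ {y} py (nAB , nZ) | inj₂ B″.[] = ⊥-elim (nZ (refl , refl))
  own-p″ {y} py (nAB , nZ) | inj₂ (s B″.∷ f) with B″.step-det s stepZ″
  ... | refl with B″.cmp (B″.toFwd py) (B″.toFwd p″AB)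
  ...   | inj₁ g = inj₂ (sq ∷ T′.transfer-fwd f (λ {z} fz s′ fw → rEq′ {z} (OH″.strictB s′ (fw B″.++ᶠ g) , OH″.strictA stepZ″ fz))
                        , T′.transfer-fwd g (λ {z} fz s′ fw → rEq′ {z} (OH″.strictB s′ fw , OH″.strictA stepZ″ (f B″.++ᶠ fz)))
                        , λ e → nZ (cong row e , cong col e))
  ...   | inj₂ B″.[] = ⊥-elim (nAB (refl , refl))
  ...   | inj₂ (s₂ B″.∷ f₂) with T′.transfer-step-side (sym eqBA) s₂
  ...     | s₂H = inj₁ (pyH , (λ { (_ , g , _) → nAB (cong row (fwd-antisym g (s₂H ∷ f₂H)) , cong col (fwd-antisym g (s₂H ∷ f₂H))) }) , notMidQ-p pyH)
    where
    f₂H = T′.transfer-fwd f₂ (λ {z} fz s′ fw → rEq′ {z} (OH″.strictA s₂ fz , OH″.aAB-notZ (s₂ B″.∷ fz)))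
    pyH = (ppAB ▸ s₂H) ++ᵖ toPath f₂H

  own-q″ : ∀ {y} → B″.Path (src q) y → NotS2 y → (Path (src q) y × ¬ MidP y × ¬ MidQ y) ⊎ MidP y
  own-q″ {y} py (nAB , nZ) with B″.cmp (B″.toFwd py) (B″.toFwd preq″)
  ... | inj₁ f with T′.transfer-fwd f (λ {z} fz s fw → rEq′ {z} (OH″.bZ-notAB (s B″.∷ fw) , OH″.strictB s fw))
  ...   | fH with T′.transfer-prefix py (λ {z} pz s fw → rEq′ {z} (OH″.bZ-notAB (s B″.∷ (fw B″.++ᶠ f)) , OH″.strictB s (fw B″.++ᶠ f)))
  ...     | pyH = inj₁ (pyH , notMidP-q pyH , (λ { (g1 , _ , ne) → ne (fwd-antisym fH g1) }))
  own-q″ {y} py (nAB , nZ) | inj₂ B″.[] = ⊥-elim (nZ (refl , refl))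
  own-q″ {y} py (nAB , nZ) | inj₂ (s B″.∷ f) with B″.step-det s stepZq″
  ... | refl with B″.cmp (B″.toFwd py) (B″.toFwd q″AB)
  ...   | inj₁ g = inj₂ (sp ∷ T′.transfer-fwd f (λ {z} fz s′ fw → rEq′ {z} (OH″.strictB s′ (fw B″.++ᶠ g) , OH″.strictA stepZq″ fz))
                        , T′.transfer-fwd g (λ {z} fz s′ fw → rEq′ {z} (OH″.strictB s′ fw , OH″.strictA stepZq″ (f B″.++ᶠ fz)))
                        , λ e → nZ (cong row e , cong col e))
  ...   | inj₂ B″.[] = ⊥-elim (nAB (refl , refl))
  ...   | inj₂ (s₂ B″.∷ f₂) with T′.transfer-step-side (sym eqAB) s₂
  ...     | s₂H = inj₁ (pyH , notMidP-q pyH , (λ { (_ , g , _) → nAB (cong row (fwd-antisym g (s₂H ∷ f₂H)) , cong col (fwd-antisym g (s₂H ∷ f₂H))) }))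
    where
    f₂H = T′.transfer-fwd f₂ (λ {z} fz s′ fw → rEq′ {z} (OH″.strictA s₂ fz , OH″.aAB-notZ (s₂ B″.∷ fz)))
    pyH = (pqAB ▸ s₂H) ++ᵖ toPath f₂H

  exits-preserved″ : ExitsPreserved H″
  exits-preserved″ c cN with c ≟ p | c ≟ q
  ... | yes refl | _ = proj₁ (proj₁ core p pN) , proj₁ (proj₂ (proj₁ core p pN)) , p-exits″
  ... | no _ | yes refl = proj₁ (proj₁ core q qN) , proj₁ (proj₂ (proj₁ core q qN)) , q-exits″
  ... | no np | no nq with proj₁ core c cN
  ...   | r , c0 , cH = r , c0 , T.transfer-exits (λ z pz → rEq {z} (notS2-other np nq pz)) cH

  q<p-at-cross : q < p × ExitsAbove p q
  q<p-at-cross with proj₂ core a′ b′ q hZ qN pqZ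
  ... | v , vN , pv , lt , el with pipe-inj pv ppZ
  ...   | refl = lt , el

  exits-above-trans : ∀ {u v w} → v < N → ExitsAbove u v → ExitsAbove v w → ExitsAbove u w
  exits-above-trans {v = v} vN e1 e2 ru rw cu cw with proj₁ core v vN
  ... | rv , cv , _ = <-trans (e1 ru rv cu cv) (e2 rv rw cv cw)

  crosses-ordered″ : CrossesOrdered H″
  crosses-ordered″ i j h e hN ph with (i ≟ A) ×-dec (j ≟ B)
  ... | yes (refl , refl) with B″.pipe-inj ph q″AB
  ...   | refl = p , pN , p″AB , q<p-at-cross
  crosses-ordered″ i j h e hN ph | no nAB with (i ≟ a′) ×-dec (j ≟ b′)
  ... | yes (refl , refl) = case trans (sym h″Z) e of λ ()
  ... | no nZ = hcase
    where
    cr : H i j ≡ cross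
    cr = trans (sym (swapCB-elsewhere H A B a′ b′ i j nAB nZ)) e
    caseA : Path (src h) (i , j , fromW) → Σ ℕ λ v → v < N × B″.Path (src v) (i , j , fromS) × h < v × ExitsAbove v h
    caseA phH with proj₂ core i j h cr hN phH
    ... | v , vN , pv , lt , el with v ≟ p | v ≟ q
    ...   | yes refl | _ with own-p pv (nAB , nZ)
    ...     | inj₁ (pv″ , _ , _) = v , vN , pv″ , lt , el
    ...     | inj₂ (mp , pq″) = q , qN , pq″ , midP-cross-ordered cr hN phH mp
    caseA phH | v , vN , pv , lt , el | no _ | yes refl with own-q pv (nAB , nZ)
    ...     | inj₁ (pv″ , _ , _) = v , vN , pv″ , lt , el
    ...     | inj₂ (mq , pp″) = p , pN , pp″ , <-trans lt (proj₁ q<p-at-cross) , exits-above-trans qN (proj₂ q<p-at-cross) el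
    caseA phH | v , vN , pv , lt , el | no np | no nq = v , vN , proj₁ (own-other np nq pv) , lt , el
    hcase : Σ ℕ λ v → v < N × B″.Path (src v) (i , j , fromS) × h < v × ExitsAbove v h
    hcase with h ≟ p | h ≟ q
    ... | yes refl | _ with own-p″ ph (nAB , nZ)
    ...   | inj₁ (phH , _ , _) = caseA phH
    ...   | inj₂ mq with proj₂ core i j q cr qN (midQ-q mq)
    ...     | r , rN , pr , q<r , _ = ⊥-elim (midQ-cross-impossible cr rN pr mq q<r)
    hcase | no _ | yes refl with own-q″ ph (nAB , nZ)
    ...   | inj₁ (phH , _ , _) = caseA phH
    ...   | inj₂ mp = ⊥-elim (nh (midP-p mp) cr)
    hcase | no np | no nq = caseA (proj₁ (own-other″ np nq ph))

  core″ : Core H″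
  core″ = exits-preserved″ , crosses-ordered″

  bumps″ : BumpOnlyAt H″ a′ b′
  bumps″ i j e with (i ≟ A) ×-dec (j ≟ B)
  ... | yes (refl , refl) = case trans (sym h″AB) e of λ ()
  ... | no nAB with (i ≟ a′) ×-dec (j ≟ b′)
  ...   | yes (refl , refl) = refl , refl
  ...   | no nZ = ⊥-elim (nAB (bumpsH i j (trans (sym (swapCB-elsewhere H A B a′ b′ i j nAB nZ)) e)))

  inv″ : DroopInvariant H″ a′ b′
  inv″ = core″ , bumps″ , p , kp , pre″

module RowEntry (N : ℕ) (G : Grid) where
  open Pipes N G
  module Ge = SharedCells N G
  row-entry : ∀ {c i j d} → Path (src c) (i , j , d) → route (G i j) d ≡ just toE →
            Σ ℕ λ j″ → j″ ≤ j × Path (src c) (i , j″ , fromS) × route (G i j″) fromS ≡ just toE ×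
              (∀ j‴ → j″ < j‴ → j‴ ≤ j → Path (src c) (i , j‴ , fromW))
  row-entry {d = fromS} pc e = _ , ≤-refl , pc , e , λ j‴ l1 l2 → ⊥-elim (<-irrefl refl (<-≤-trans l1 l2))
  row-entry {c} {i} {suc j} {fromW} pc e with Ge.pred-W pc
  ... | d′ , pc′ , e′ with row-entry pc′ e′
  ...   | j″ , le , ps , es , all = j″ , ≤-trans le (n≤1+n j) , ps , es , ext
    where
    ext : ∀ j‴ → j″ < j‴ → j‴ ≤ suc j → Path (src c) (i , j‴ , fromW)
    ext j‴ l1 l2 with m≤n⇒m<n∨m≡n l2
    ... | inj₂ refl = pc
    ... | inj₁ l3 = all j‴ l1 (s≤s⁻¹ l3)
  row-entry {c} {i} {zero} {fromW} (_ ▸ ()) e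

route-SE⇒rel⊎bump : ∀ {t} → route t fromS ≡ just toE → t ≡ rel ⊎ t ≡ bump
route-SE⇒rel⊎bump {rel} _ = inj₁ refl
route-SE⇒rel⊎bump {bump} _ = inj₂ refl
route-SE⇒rel⊎bump {blank} ()
route-SE⇒rel⊎bump {hor} ()
route-SE⇒rel⊎bump {ver} ()
route-SE⇒rel⊎bump {cross} ()
route-SE⇒rel⊎bump {jel} ()

rel⊎bump⇒route-SE : ∀ {t} → t ≡ rel ⊎ t ≡ bump → route t fromS ≡ just toE
rel⊎bump⇒route-SE (inj₁ refl) = refl
rel⊎bump⇒route-SE (inj₂ refl) = refl

module InsertionSteps (N : ℕ) (G₀ : Grid) (k : ℕ) (mono : Invariant.LabelsIncreasing N G₀ k) where
  open Invariant N G₀ k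

  droop-pipe-never-horizontal : ∀ {G a b} → DroopInvariant G a b → ∀ c → Visits N G c (a , b , fromS) →
                                ∀ i j → G i j ≡ cross → ¬ Visits N G c (i , j , fromW)
  droop-pipe-never-horizontal {G} (core , _ , p , kp , pa) c vc i j cr vw
    with Pipes.visits⇒path N G vc | Pipes.visits⇒path N G vw
  ... | _ , pc , _ | _ , pw , _ with Pipes.pipe-inj N G pc pa
  ...   | refl = no-horizontal-cross mono core kp pw cr

  droop-width-one : ∀ {G G′ a b x y} → DroopInvariant G a b → MinDroop N G a b x y G′ → y ≡ 1
  droop-width-one {G} {G′} {a} {b} {x} {y} (core , bumps , p , kp , pa) (hab , _ , (hy , hby , hcr , _) , _) with y
  ... | zero = ⊥-elim (<-irrefl refl hy)
  ... | suc zero = refl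
  ... | suc (suc y′) = ⊥-elim (no-horizontal-cross mono core kp pB1 cr)
    where
    open Pipes N G
    eab : route (G a b) fromS ≡ just toE
    eab = rel⊎bump⇒route-SE hab
    lt : suc b < N
    lt = ≤-<-trans (subst (_≤ b + suc (suc y′)) (+-comm b 1) (+-monoʳ-≤ b (s≤s (z≤n {suc y′})))) hby
    pB1 : Path (src p) (a , suc b , fromW)
    pB1 = pa ▸ stE eab lt
    cr : G a (suc b) ≡ cross
    cr = subst (λ j → G a j ≡ cross) (+-comm b 1) (hcr 1 (s≤s z≤n) (s≤s (s≤s z≤n)))

  DroopOutcome : Grid → ℕ → ℕ → ℕ → Set
  DroopOutcome G′ a b x = Core G′ × BumpOnlyAt G′ (a + x) (suc b) × Σ ℕ λ p → ExitsAboveK p × Pipes.Path N G′ (Pipes.src N G′ p) (a + x , suc b , fromW) ×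
    ((G′ (a + x) b ≡ rel × Pipes.Path N G′ (Pipes.src N G′ p) (a + x , b , fromS)) ⊎
     (G′ (a + x) b ≡ hor × Pipes.Path N G′ (Pipes.src N G′ p) (a + x , b , fromW)))

  droop-outcome : ∀ {G G′ a b x} → DroopInvariant G a b → MinDroop N G a b x 1 G′ → DroopOutcome G′ a b x
  droop-outcome {x = zero} inv (_ , (() , _) , _)
  droop-outcome {G} {G′} {a} {b} {suc x′} (core , bumps , p , kp , pa) (hab , (hx , hax , hcr , hncr) , (hy , hby , _ , _) , hdt) =
    D.core′ , D.bumps′ , p , kp , D.p′axb1 , D.corner-tile
    where
    hb1 : suc b < N
    hb1 = subst (_< N) (+-comm b 1) hby
    module D = DroopStep N G₀ k G G′ a b x′ p core bumps kp pa hax hb1 hdt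

  droop-width-and-outcome : ∀ {G G′ a b x y} → DroopInvariant G a b → MinDroop N G a b x y G′ → y ≡ 1 × DroopOutcome G′ a b x
  droop-width-and-outcome inv md with droop-width-one inv md
  ... | refl = refl , droop-outcome inv md

  stepJ-inv : ∀ {G G′ a b x y j₂} → DroopInvariant G a b → MinDroop N G a b x y G′ → G′ (a + x) (b + y) ≡ jel →
              j₂ < b + y → G′ (a + x) j₂ ≡ rel → (∀ j → j₂ < j → j < b + y → G′ (a + x) j ≢ rel) → DroopInvariant G′ (a + x) j₂
  stepJ-inv {G} {G′} {a} {b} {x} {y} {j₂} inv md hj lt2 hr hmax with droop-width-and-outcome inv md
  ... | refl , core′ , bumps′ , p , kp , pAB , info = core′ , bumps″ , p , kp , pathK info
    where
    open Pipes N G′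
    hjel : G′ (a + x) (suc b) ≡ jel
    hjel = subst (λ j → G′ (a + x) j ≡ jel) (+-comm b 1) hj
    bumps″ : BumpOnlyAt G′ (a + x) j₂
    bumps″ i j e with bumps′ i j e
    ... | refl , refl = case trans (sym hjel) e of λ ()
    j₂≤b : j₂ ≤ b
    j₂≤b = s≤s⁻¹ (subst (j₂ <_) (+-comm b 1) lt2)
    lt-b1 : ∀ {j} → j ≤ b → j < b + 1
    lt-b1 {j} le = subst (j <_) (sym (+-comm b 1)) (s≤s le)
    pN = proj₁ kp
    cpP = proj₂ (proj₂ (proj₁ core′ p pN))
    pathK : ((G′ (a + x) b ≡ rel × Path (src p) (a + x , b , fromS)) ⊎ (G′ (a + x) b ≡ hor × Path (src p) (a + x , b , fromW)))
            → Path (src p) (a + x , j₂ , fromS)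
    pathK (inj₁ (g , ps)) with m≤n⇒m<n∨m≡n j₂≤b
    ... | inj₂ refl = ps
    ... | inj₁ l = ⊥-elim (hmax b l (lt-b1 ≤-refl) g)
    pathK (inj₂ (g , pw)) with RowEntry.row-entry N G′ pw (cong (λ t → route t fromW) g)
    ... | j″ , le , ps , es , all with m≤n⇒m<n∨m≡n le
    ...   | inj₂ refl = case SharedCells.same-side N G′ ps pw of λ ()
    ...   | inj₁ j″<b with route-SE⇒rel⊎bump es
    ...     | inj₂ eb with bumps′ _ _ eb
    ...       | _ , e2 = ⊥-elim (<-irrefl e2 (<-trans j″<b (n<1+n b)))
    pathK (inj₂ (g , pw)) | j″ , le , ps , es , all | inj₁ j″<b | inj₁ er with <-cmp j₂ j″
    ... | tri≈ _ refl _ = ps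
    ... | tri< l _ _ = ⊥-elim (hmax j″ l (lt-b1 (<⇒≤ j″<b)) er)
    ... | tri> _ _ l with PipeRegions.OfPipe.on-route N G′ p pN cpP (all j₂ l j₂≤b)
    ...   | o , eo rewrite hr with eo
    ...     | ()

  stepBump-inv : ∀ {G G′ a b x y c r} → DroopInvariant G a b → MinDroop N G a b x y G′ → G′ (a + x) (b + y) ≡ bump →
                 Visits N G′ c (a + x , b + y , fromS) → ExitsRow N G′ c r → suc r ≤ k → DroopInvariant G′ (a + x) (b + y)
  stepBump-inv {G} {G′} {a} {b} {x} {y} {c} {r} inv md hb vc er rk with droop-width-and-outcome inv md
  ... | refl , core′ , bumps′ , p , kp , pAB , info = core′ , bumps″ , c , kc , proj₁ (proj₂ (B′.visits⇒path vc))
    where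
    module B′ = Pipes N G′
    module B₀′ = Pipes N G₀
    bumps″ : BumpOnlyAt G′ (a + x) (b + 1)
    bumps″ i j e with bumps′ i j e
    ... | e1 , e2 = e1 , trans e2 (sym (+-comm b 1))
    cN : c < N
    cN = proj₁ (B′.visits⇒path vc)
    kc : ExitsAboveK c
    kc = cN , λ r′ c0 → go r′ c0
      where
      go : ∀ r′ → B₀′.Exits c r′ → r′ < k
      go r′ c0 with proj₁ core′ c cN
      ... | r₁ , c01 , c′1 with B₀′.exits-unique c0 c01 | B′.exits-unique (proj₂ (B′.exitsRow⇒exits er)) c′1
      ...   | refl | refl = rk

  stepSwap-inv : ∀ {G G′ a b x y c₁ c₂ a′ b′} → DroopInvariant G a b → MinDroop N G a b x y G′ → G′ (a + x) (b + y) ≡ bump →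
                 Visits N G′ c₁ (a + x , b + y , fromW) → Visits N G′ c₂ (a + x , b + y , fromS) →
                 G′ a′ b′ ≡ cross → VisitsCell N G′ c₁ a′ b′ → VisitsCell N G′ c₂ a′ b′ →
                 DroopInvariant (swapCB G′ (a + x) (b + y) a′ b′) a′ b′
  stepSwap-inv {G} {G′} {a} {b} {x} {y} {c₁} {c₂} {a′} {b′} inv md hb v1 v2 hz vc1 vc2 with droop-width-and-outcome inv md
  ... | refl , core′ , bumps′ , p , kp , pAB , info = SP.inv″
    where
    module B′ = Pipes N G′
    bumps″ : BumpOnlyAt G′ (a + x) (b + 1)
    bumps″ i j e with bumps′ i j e
    ... | e1 , e2 = e1 , trans e2 (sym (+-comm b 1))
    ppAB : B′.Path (B′.src p) (a + x , b + 1 , fromW)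
    ppAB = subst (λ j → B′.Path (B′.src p) (a + x , j , fromW)) (sym (+-comm b 1)) pAB
    c₁≡p : c₁ ≡ p
    c₁≡p = B′.pipe-inj (proj₁ (proj₂ (B′.visits⇒path v1))) ppAB
    ppZ′ : Σ In λ d → B′.Path (B′.src p) (a′ , b′ , d)
    ppZ′ = proj₁ vc1 , subst (λ c → B′.Path (B′.src c) (a′ , b′ , proj₁ vc1)) c₁≡p (proj₁ (proj₂ (B′.visits⇒path (proj₂ vc1))))
    pqZ′ : Σ In λ d → B′.Path (B′.src c₂) (a′ , b′ , d)
    pqZ′ = proj₁ vc2 , proj₁ (proj₂ (B′.visits⇒path (proj₂ vc2)))
    module SP = SwapStep N G₀ k mono G′ core′ (a + x) (b + 1) p c₂ a′ b′ bumps″ kp (proj₁ (B′.visits⇒path v2))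
                  ppAB (proj₁ (proj₂ (B′.visits⇒path v2))) hb hz ppZ′ pqZ′

module CrossOrder (N : ℕ) (G : Grid) where
  open Pipes N G
  module Go = PipeRegions N G
  module Ge = SharedCells N G

  cross-order : ∀ {v h i j rv rh} → v < N → h < N → Exits v rv → Exits h rh →
       Path (src v) (i , j , fromS) → Path (src h) (i , j , fromW) → G i j ≡ cross →
       (∀ {i′ j′ d d′} → Path (src v) (i′ , j′ , d) → Path (src h) (i′ , j′ , d′) → i′ ≡ i × j′ ≡ j) →
       h < v × rv < rh
  cross-order {v} {h} {i} {j} {rv} {rh} vN hN cv ch pv ph cr uniq = before , after
    where
    module GH = Go.OfPipe h hN ch
    module GV = Go.OfPipe v vN cv
    after : rv < rh
    after with GV.zF | GV.on-before pv | GV.fF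
    ... | z | [] | fin e _ rewrite cr with e
    ...   | ()
    after | z | s ∷ f | fz with GH.shared-leave ph fromS≢fromW s
    ... | inj₂ (e , _) rewrite cr with e
    ...   | ()
    after | z | s ∷ f | fz | inj₁ (_ , ab) with GH.walk-above (proj₁ (fwd-mono (toFwd (pv ▸ s)))) ab f
    ...   | inj₂ ((i′ , j′ , d′) , g1 , g2 , (dh , phw) , _) with uniq ((pv ▸ s) ++ᵖ toPath g1) phw
    ...     | refl , refl = ⊥-elim (step-no-return s g1)
    after | (zi , zj , zd) | s ∷ f | fin e nl | inj₁ (_ , ab) | inj₁ abz =
      GH.end-above (≤-antisym (Go.path-colN vN (pv ++ᵖ toPath f′)) (≮⇒≥ nl)) abz
      where f′ = s ∷ f
    before : h < v
    before with GH.trichotomy (N ∸ 1) v vN ≤-refl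
    ... | inj₂ (inj₂ bl) = GH.start-below bl
    ... | inj₂ (inj₁ (dh , ph0)) with uniq ε ph0
    ...   | refl , refl = GH.pathW-col ph
    before | inj₁ ab with GH.walk-above ≤-refl ab (toFwd pv)
    ... | inj₁ ab′ = ⊥-elim (GH.above-not-on ab′ (fromW , ph))
    ... | inj₂ ((i′ , j′ , .fromW) , g1 , g2 , (dh , phw) , refl) with uniq (toPath g1) phw
    ...   | refl , refl = ⊥-elim (fromW≢fromS (Ge.same-side (toPath g1) pv))

hasS-r : ∀ {t o} → route t fromS ≡ just o → hasS t ≡ true
hasS-r {ver} _ = refl
hasS-r {cross} _ = refl
hasS-r {rel} _ = refl
hasS-r {bump} _ = refl
hasS-r {blank} ()
hasS-r {hor} ()
hasS-r {jel} ()

hasW-r : ∀ {t o} → route t fromW ≡ just o → hasW t ≡ true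
hasW-r {hor} _ = refl
hasW-r {cross} _ = refl
hasW-r {jel} _ = refl
hasW-r {bump} _ = refl
hasW-r {blank} ()
hasW-r {ver} ()
hasW-r {rel} ()

hasN-r : ∀ {t} → hasN t ≡ true → Σ In λ d → route t d ≡ just toN
hasN-r {ver} _ = fromS , refl
hasN-r {cross} _ = fromS , refl
hasN-r {jel} _ = fromW , refl
hasN-r {bump} _ = fromW , refl
hasN-r {blank} ()
hasN-r {hor} ()
hasN-r {rel} ()

hasE-r : ∀ {t} → hasE t ≡ true → Σ In λ d → route t d ≡ just toE
hasE-r {hor} _ = fromW , refl
hasE-r {cross} _ = fromW , refl
hasE-r {rel} _ = fromS , refl
hasE-r {bump} _ = fromS , refl
hasE-r {blank} ()
hasE-r {ver} ()
hasE-r {jel} ()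

module Embedding (n : ℕ) (D : Grid) where
  G₀ : Grid
  G₀ = embed n D

  emb-in : ∀ {i j} → i < n → j < n → G₀ i j ≡ D i j
  emb-in {i} {j} l1 l2 rewrite <ᵇ-true l1 | <ᵇ-true l2 = refl

  emb-out : ∀ {i j} → ¬ (i < n × j < n) → G₀ i j ≡ (if i ≡ᵇ j then rel else (if i <ᵇ j then hor else ver))
  emb-out {i} {j} ne with i <? n
  ... | no n1 rewrite <ᵇ-false n1 = refl
  ... | yes l1 with j <? n
  ...   | yes l2 = ⊥-elim (ne (l1 , l2))
  ...   | no n2 rewrite <ᵇ-true l1 | <ᵇ-false n2 = refl

  emb-rel : ∀ {i} → n ≤ i → G₀ i i ≡ rel
  emb-rel {i} le rewrite emb-out {i} {i} (λ { (l , _) → <-irrefl refl (<-≤-trans l le) }) | ≡ᵇ-true {i} refl = refl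

  emb-hor : ∀ {i j} → i < j → n ≤ j → G₀ i j ≡ hor
  emb-hor {i} {j} lt le rewrite emb-out {i} {j} (λ { (_ , l) → <-irrefl refl (<-≤-trans l le) }) | ≡ᵇ-false (<⇒≢ lt) | <ᵇ-true lt = refl

  emb-ver : ∀ {i j} → j < i → n ≤ i → G₀ i j ≡ ver
  emb-ver {i} {j} lt le rewrite emb-out {i} {j} (λ { (l , _) → <-irrefl refl (<-≤-trans l le) }) | ≡ᵇ-false (>⇒≢ lt) | <ᵇ-false (<-asym lt) = refl

  emb-out-tile : ∀ {i j} → ¬ (i < n × j < n) → G₀ i j ≡ rel ⊎ G₀ i j ≡ hor ⊎ G₀ i j ≡ ver
  emb-out-tile {i} {j} ne rewrite emb-out {i} {j} ne with i ≟ j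
  ... | yes refl rewrite ≡ᵇ-true {i} refl = inj₁ refl
  ... | no ne′ rewrite ≡ᵇ-false ne′ with i <? j
  ...   | yes l rewrite <ᵇ-true l = inj₂ (inj₁ refl)
  ...   | no nl rewrite <ᵇ-false nl = inj₂ (inj₂ refl)

  emb-out-hook-tile : ∀ {i j t} → ¬ (i < n × j < n) → G₀ i j ≡ t → t ≡ rel ⊎ t ≡ hor ⊎ t ≡ ver
  emb-out-hook-tile out-D refl = emb-out-tile out-D

  emb-cross-in : ∀ {i j} → G₀ i j ≡ cross → i < n × j < n
  emb-cross-in {i} {j} e with (i <? n) ×-dec (j <? n)
  ... | yes in-D = in-D
  ... | no out-D with emb-out-hook-tile out-D e
  ...   | inj₁ ()
  ...   | inj₂ (inj₁ ())
  ...   | inj₂ (inj₂ ())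

module Initial (n N : ℕ) (π : Permutation′ n) (D : Grid) (bpd : IsBPD n π D) (nN : n < N) where
  open Embedding n D
  module B₀ = Pipes N G₀
  module BD = Pipes n D
  module GoD = PipeRegions n D
  module Go₀ = PipeRegions N G₀
  open B₀ using (src)

  nb = proj₁ bpd
  eh = proj₁ (proj₂ bpd)
  ev = proj₁ (proj₂ (proj₂ bpd))
  lw = proj₁ (proj₂ (proj₂ (proj₂ bpd)))
  exD = proj₁ (proj₂ (proj₂ (proj₂ (proj₂ (proj₂ (proj₂ (proj₂ bpd)))))))
  crD = proj₂ (proj₂ (proj₂ (proj₂ (proj₂ (proj₂ (proj₂ (proj₂ bpd)))))))

  emb-nobump : ∀ i j → G₀ i j ≢ bump
  emb-nobump i j e with (i <? n) ×-dec (j <? n)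
  ... | yes (l1 , l2) = nb i j l1 l2 (trans (sym (emb-in l1 l2)) e)
  ... | no out-D with emb-out-hook-tile out-D e
  ...   | inj₁ ()
  ...   | inj₂ (inj₁ ())
  ...   | inj₂ (inj₂ ())

  verN : ∀ {i j} → G₀ i j ≡ ver → route (G₀ i j) fromS ≡ just toN
  verN e rewrite e = refl

  column-climb′ : ∀ c d i → i + d ≡ N ∸ 1 → (∀ i′ → i < i′ → i′ ≤ N ∸ 1 → G₀ i′ c ≡ ver) → B₀.Path (src c) (i , c , fromS)
  column-climb′ c zero i e hyp = subst (λ k → B₀.Path (src c) (k , c , fromS)) (sym (trans (sym (+-identityʳ i)) e)) B₀.ε
  column-climb′ c (suc d) i e hyp =
    column-climb′ c d (suc i) (trans (sym (+-suc i d)) e) (λ i′ l1 l2 → hyp i′ (<-trans (n<1+n i) l1) l2)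
      B₀.▸ B₀.stN (verN (hyp (suc i) (n<1+n i) (subst (suc i ≤_) e (subst (_≤ i + suc d) (+-comm i 1) (+-monoʳ-≤ i (s≤s z≤n))))))

  column-climb : ∀ c i → i ≤ N ∸ 1 → (∀ i′ → i < i′ → i′ ≤ N ∸ 1 → G₀ i′ c ≡ ver) → B₀.Path (src c) (i , c , fromS)
  column-climb c i le hyp = column-climb′ c (N ∸ 1 ∸ i) i (m+[n∸m]≡n le) hyp

  finishRow′ : ∀ f {x r j₀ d} → j₀ + f ≡ N → B₀.Path x (r , j₀ , d) → route (G₀ r j₀) d ≡ just toE →
               (∀ j′ → j₀ < j′ → j′ < N → G₀ r j′ ≡ hor) → Σ Cell λ z → B₀.Path x z × B₀.Final z r
  finishRow′ zero {j₀ = j₀} e p re hyp = _ , p , B₀.fin re (λ l → <-irrefl refl (<-trans (n<1+n N) (subst (λ k → suc k < N) (trans (sym (+-identityʳ j₀)) e) l)))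
  finishRow′ (suc f) {x} {r} {j₀} e p re hyp with suc j₀ <? N
  ... | no nl = _ , p , B₀.fin re nl
  ... | yes l = finishRow′ f (trans (sym (+-suc j₀ f)) e) (p B₀.▸ B₀.stE re l) hw (λ j′ l1 l2 → hyp j′ (<-trans (n<1+n j₀) l1) l2)
    where
    hw : route (G₀ r (suc j₀)) fromW ≡ just toE
    hw rewrite hyp (suc j₀) (n<1+n j₀) l = refl

  finishRow : ∀ {x r j₀ d} → j₀ ≤ N → B₀.Path x (r , j₀ , d) → route (G₀ r j₀) d ≡ just toE →
              (∀ j′ → j₀ < j′ → j′ < N → G₀ r j′ ≡ hor) → Σ Cell λ z → B₀.Path x z × B₀.Final z r
  finishRow {j₀ = j₀} le = finishRow′ (N ∸ j₀) (m+[n∸m]≡n le)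

  relE : ∀ {i j} → G₀ i j ≡ rel → route (G₀ i j) fromS ≡ just toE
  relE e rewrite e = refl

  -- Outside D the embedded grid consists of hooks: pipe c ≥ n goes up column c to the diagonal
  -- and then east along row c.
  exits-large : ∀ c → n ≤ c → c < N → B₀.Exits c c
  exits-large c le cN = finishRow (<⇒≤ cN) (column-climb c c (<⇒≤pred cN) (λ i′ l1 l2 → emb-ver l1 (≤-trans le (<⇒≤ l1))))
                      (relE (emb-rel le)) (λ j′ l1 l2 → emb-hor l1 (≤-trans le (<⇒≤ l1)))

  embStep : ∀ {y y′} → BD.Step y y′ → BD.row y < n → BD.col y < n → B₀.Step y y′
  embStep {suc i , j , d} (BD.stN e) r c = B₀.stN (trans (cong (λ t → route t d) (emb-in r c)) e)
  embStep {i , j , d} (BD.stE e l) r c = B₀.stE (trans (cong (λ t → route t d) (emb-in r c)) e) (<-trans l nN)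

  embPath : ∀ {c y} → c < n → BD.Path (BD.src c) y → B₀.Path (n ∸ 1 , c , fromS) y
  embPath cn BD.ε = B₀.ε
  embPath cn (p BD.▸ s) = embPath cn p B₀.▸ embStep s (≤-<-trans (BD.path-mono p .proj₁) (m<n⇒pred[n]<n cn)) (GoD.path-colN cn p)

  apprSmall : ∀ c → c < n → B₀.Path (src c) (n ∸ 1 , c , fromS)
  apprSmall c cn = column-climb c (n ∸ 1) (∸-monoˡ-≤ 1 (<⇒≤ nN)) (λ i′ l1 l2 → emb-ver (<-≤-trans cn (pred[m]<n⇒m≤n l1)) (pred[m]<n⇒m≤n l1))

  toD : ∀ {c y} → c < n → BD.Path (BD.src c) y → B₀.Path (src c) y
  toD cn p = apprSmall _ cn B₀.++ᵖ embPath cn p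

  exits-in-D : ∀ c → (cn : c < n) → BD.Exits c (toℕ (π ⟨$⟩ˡ fromℕ< cn))
  exits-in-D c cn with exD (fromℕ< cn)
  ... | ex = proj₂ (BD.exitsRow⇒exits (subst (λ c′ → ExitsRow n D c′ (toℕ (π ⟨$⟩ˡ fromℕ< cn))) (toℕ-fromℕ< cn) ex))

  exits-small : ∀ c → (cn : c < n) → B₀.Exits c (toℕ (π ⟨$⟩ˡ fromℕ< cn))
  exits-small c cn with exits-in-D c cn
  ... | (r , jf , d) , pD , BD.fin e nl = finishRow (<⇒≤ jfN) (toD cn pD) e′ hh
    where
    jfn : jf < n
    jfn = GoD.path-colN cn pD
    jfN : jf < N
    jfN = <-trans jfn nN
    rn : r < n
    rn = ≤-<-trans (GoD.path-rowN pD) (m<n⇒pred[n]<n cn)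
    e′ : route (G₀ r jf) d ≡ just toE
    e′ = trans (cong (λ t → route t d) (emb-in rn jfn)) e
    hh : ∀ j′ → jf < j′ → j′ < N → G₀ r j′ ≡ hor
    hh j′ l1 l2 = emb-hor (<-≤-trans rn (≤-trans (≮⇒≥ nl) l1)) (≤-trans (≮⇒≥ nl) l1)

  data SmallPipeCell (c : ℕ) : Cell → Set where
    appr0 : ∀ {i} → n ≤ i → SmallPipeCell c (i , c , fromS)
    in0 : ∀ {i j d} → i < n → j < n → BD.Path (BD.src c) (i , j , d) → SmallPipeCell c (i , j , d)
    tail0 : ∀ {i j} → i < n → n ≤ j → SmallPipeCell c (i , j , fromW)

  nN1 : n ≤ N ∸ 1
  nN1 = <⇒≤pred nN

  small-pipe-cell : ∀ {c y} → c < n → B₀.Path (src c) y → SmallPipeCell c y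
  small-pipe-cell cn B₀.ε = appr0 nN1
  small-pipe-cell {c} cn (p B₀.▸ s) with small-pipe-cell cn p | s
  ... | appr0 {suc i′} le | B₀.stN e with n ≤? i′
  ...   | yes le′ = appr0 le′
  ...   | no nle = in0 (≰⇒> nle) cn (subst (λ k → BD.Path (BD.src c) (k , c , fromS)) (sym i′≡) BD.ε)
    where
    i′≡ : i′ ≡ n ∸ 1
    i′≡ = ≤-antisym (<⇒≤pred (≰⇒> nle)) (≤-trans (∸-monoˡ-≤ 1 le) ≤-refl)
  small-pipe-cell {c} cn (p B₀.▸ s) | appr0 {i} le | B₀.stE e l rewrite emb-ver (<-≤-trans cn le) le with e
  ... | ()
  small-pipe-cell {c} cn (p B₀.▸ s) | in0 {suc i′} {j} {d} il jl pD | B₀.stN e =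
    in0 (<-trans (n<1+n i′) il) jl (pD BD.▸ BD.stN (trans (cong (λ t → route t d) (sym (emb-in il jl))) e))
  small-pipe-cell {c} cn (p B₀.▸ s) | in0 {i} {j} {d} il jl pD | B₀.stE e l with suc j <? n
  ... | yes l′ = in0 il l′ (pD BD.▸ BD.stE (trans (cong (λ t → route t d) (sym (emb-in il jl))) e) l′)
  ... | no nl = tail0 il (≮⇒≥ nl)
  small-pipe-cell {c} cn (p B₀.▸ s) | tail0 {i} {j} il le | B₀.stE e l = tail0 il (≤-trans le (n≤1+n j))
  small-pipe-cell {c} cn (p B₀.▸ s) | tail0 {suc i′} {j} il le | B₀.stN e rewrite emb-hor (<-≤-trans il le) le with e
  ... | ()

  data LargePipeCell (c : ℕ) : Cell → Set where
    colB : ∀ {i} → c ≤ i → LargePipeCell c (i , c , fromS)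
    rowB : ∀ {j} → c < j → LargePipeCell c (c , j , fromW)

  large-pipe-cell : ∀ {c y} → n ≤ c → c < N → B₀.Path (src c) y → LargePipeCell c y
  large-pipe-cell nc cN B₀.ε = colB (<⇒≤pred cN)
  large-pipe-cell {c} nc cN (p B₀.▸ s) with large-pipe-cell nc cN p | s
  ... | colB {suc i′} le | B₀.stN e with c ≟ suc i′
  ...   | yes refl rewrite emb-rel nc with e
  ...     | ()
  large-pipe-cell {c} nc cN (p B₀.▸ s) | colB {suc i′} le | B₀.stN e | no ne = colB (s≤s⁻¹ (≤∧≢⇒< le ne))
  large-pipe-cell {c} nc cN (p B₀.▸ s) | colB {i} le | B₀.stE e l with c ≟ i
  ... | yes refl = rowB (n<1+n c)
  ... | no ne rewrite emb-ver (≤∧≢⇒< le ne) (≤-trans nc le) with e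
  ...   | ()
  large-pipe-cell {c} nc cN (p B₀.▸ s) | rowB {j} lt | B₀.stE e l = rowB (<-trans lt (n<1+n j))
  large-pipe-cell {c} nc cN (p B₀.▸ s) | rowB {j} lt | B₀.stN e rewrite emb-hor lt (≤-trans nc (<⇒≤ lt)) with e
  ... | ()

  notInBig : ∀ {c y} → n ≤ c → LargePipeCell c y → ¬ (B₀.row y < n × B₀.col y < n)
  notInBig nc (colB _) (_ , l) = <-irrefl refl (<-≤-trans l nc)
  notInBig nc (rowB _) (l , _) = <-irrefl refl (<-≤-trans l nc)

  covered-by-pipe : ∀ f i j d {o} → (n ∸ 1 ∸ i) + j < f → i ≤ n ∸ 1 → j < n → route (D i j) d ≡ just o →
         Σ ℕ λ c → c < n × BD.Path (BD.src c) (i , j , d)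
  covered-by-pipe zero i j d () il jl e
  covered-by-pipe (suc f) i j fromS lt il jl e with i ≟ n ∸ 1
  ... | yes refl = j , jl , BD.ε
  ... | no ne with hasN-r (trans (ev i j si<n jl) (hasS-r e))
    where
    si<n : suc i < n
    si<n = ≤-<-trans (≤∧≢⇒< il ne) (m<n⇒pred[n]<n jl)
  ...   | d′ , e′ with covered-by-pipe f (suc i) j d′ lt′ (≤∧≢⇒< il ne) jl e′
    where
    lt′ : (n ∸ 1 ∸ suc i) + j < f
    lt′ = s≤s⁻¹ (subst (λ k → k + j < suc f) (m∸n≡suc[m∸suc[n]] (n ∸ 1) i (≤∧≢⇒< il ne)) lt)
  ...     | c , cn , p = c , cn , p BD.▸ BD.stN e′
  covered-by-pipe (suc f) i zero fromW lt il jl e with trans (sym (lw i (≤-<-trans il (m<n⇒pred[n]<n jl)))) (hasW-r e)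
  ... | ()
  covered-by-pipe (suc f) i (suc j) fromW lt il jl e with hasE-r (trans (eh i j (≤-<-trans il (m<n⇒pred[n]<n jl)) jl) (hasW-r e))
  ... | d′ , e′ with covered-by-pipe f i j d′ lt′ il (<-trans (n<1+n j) jl) e′
    where
    lt′ : (n ∸ 1 ∸ i) + j < f
    lt′ = s≤s⁻¹ (subst (_< suc f) (+-suc (n ∸ 1 ∸ i) j) lt)
  ...   | c , cn , p = c , cn , p BD.▸ BD.stE e′ jl

  exits₀ : ∀ c → c < N → Σ ℕ (B₀.Exits c)
  exits₀ c cN with c <? n
  ... | yes cn = _ , exits-small c cn
  ... | no nc = c , exits-large c (≮⇒≥ nc) cN

  inside-D : ∀ {c i j d} → c < N → B₀.Path (src c) (i , j , d) → i < n → j < n → c < n × BD.Path (BD.src c) (i , j , d)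
  inside-D {c} cN p il jl with c <? n
  ... | no nc = ⊥-elim (notInBig (≮⇒≥ nc) (large-pipe-cell (≮⇒≥ nc) cN p) (il , jl))
  ... | yes cn with small-pipe-cell cn p
  ...   | appr0 le = ⊥-elim (<-irrefl refl (<-≤-trans il le))
  ...   | in0 _ _ pD = cn , pD
  ...   | tail0 _ le = ⊥-elim (<-irrefl refl (<-≤-trans jl le))

  visits-D : ∀ {c i j d} → c < n → BD.Path (BD.src c) (i , j , d) → VisitsCell n D c i j
  visits-D {c} cn pD = _ , BD.path⇒visits cn (exits-in-D c cn) pD

  module Ge₀ = SharedCells N G₀

  two-pipes-cross : ∀ {i j} d d′ → d ≢ d′ → Σ Out (λ o → route (G₀ i j) d ≡ just o) → Σ Out (λ o → route (G₀ i j) d′ ≡ just o) → G₀ i j ≡ cross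
  two-pipes-cross {i} {j} d d′ ne (o , e) (o′ , e′) with tt d d′ ne e e′
    where
    tt : ∀ d d′ → d ≢ d′ → ∀ {o o′} → route (G₀ i j) d ≡ just o → route (G₀ i j) d′ ≡ just o′ → G₀ i j ≡ cross ⊎ G₀ i j ≡ bump
    tt fromS fromS ne _ _ = ⊥-elim (ne refl)
    tt fromW fromW ne _ _ = ⊥-elim (ne refl)
    tt fromS fromW _ e e′ = Ge₀.two-sides (G₀ i j) e e′
    tt fromW fromS _ e e′ = Ge₀.two-sides (G₀ i j) e′ e
  ... | inj₁ c = c
  ... | inj₂ b = ⊥-elim (emb-nobump i j b)

  onroute₀ : ∀ {c y} → c < N → B₀.Path (src c) y → Σ Out λ o → routeAt G₀ y ≡ just o
  onroute₀ {c} cN p = Go₀.OfPipe.on-route c cN (proj₂ (exits₀ c cN)) p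

  module Crosses₀ (k : ℕ) where
    open Invariant N G₀ k using (CrossesOrdered; ExitsAbove)
    crosses-ordered₀ : CrossesOrdered G₀
    crosses-ordered₀ i j h e hN ph with emb-cross-in e
    ... | il , jl with inside-D hN ph il jl
    ...   | hn , pDh with covered-by-pipe (suc ((n ∸ 1 ∸ i) + j)) i j fromS (n<1+n _) (<⇒≤pred il) jl crS
      where
      crS : route (D i j) fromS ≡ just toN
      crS rewrite trans (sym (emb-in il jl)) e = refl
    ...     | v , vn , pDv = v , vN , pv , proj₁ res , el
      where
      vN : v < N
      vN = <-trans vn nN
      pv : B₀.Path (src v) (i , j , fromS)
      pv = toD vn pDv
      v≢h : v ≢ h
      v≢h eq = fromS≢fromW (Ge₀.same-side pv (subst (λ c → B₀.Path (src c) (i , j , fromW)) (sym eq) ph))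
      De : D i j ≡ cross
      De = trans (sym (emb-in il jl)) e
      uniq : ∀ {i′ j′ d d′} → B₀.Path (src v) (i′ , j′ , d) → B₀.Path (src h) (i′ , j′ , d′) → i′ ≡ i × j′ ≡ j
      uniq {i′} {j′} {d} {d′} pv′ ph′ with two-pipes-cross d d′ (Ge₀.diff-pipes pv′ ph′ v≢h) (onroute₀ vN pv′) (onroute₀ hN ph′)
      ... | c′ with emb-cross-in c′
      ...   | il′ , jl′ with inside-D vN pv′ il′ jl′ | inside-D hN ph′ il′ jl′
      ...     | _ , pDv′ | _ , pDh′ with crD v h v≢h i j i′ j′ De (trans (sym (emb-in il′ jl′)) c′)
                                     (visits-D vn pDv) (visits-D hn pDh) (visits-D vn pDv′) (visits-D hn pDh′)
      ...       | e1 , e2 = sym e1 , sym e2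
      cv = proj₂ (exits₀ v vN)
      ch = proj₂ (exits₀ h hN)
      res = CrossOrder.cross-order N G₀ vN hN cv ch pv ph e uniq
      el : ExitsAbove v h
      el rv rh cv′ ch′ with B₀.exits-unique cv cv′ | B₀.exits-unique ch ch′
      ... | refl | refl = proj₂ res

  module BeforeFirstDescent (d : ℕ) (fd : FirstDescent π d) where
    πr : Fin n → ℕ
    πr s = toℕ (π ⟨$⟩ʳ s)

    d<n : d < n
    d<n with proj₁ fd
    ... | i , j , e1 , e2 , _ = subst (_< n) e2 (toℕ<n j)

    ascent-before-d : ∀ (s t : Fin n) → suc (toℕ s) ≡ toℕ t → toℕ t < d → πr s < πr t
    ascent-before-d s t e td with <-cmp (πr s) (πr t)
    ... | tri< l _ _ = l
    ... | tri> _ _ l = ⊥-elim (proj₂ fd (toℕ t) td (s , t , e , refl , l))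
    ... | tri≈ _ eq _ = ⊥-elim (<-irrefl (cong toℕ s≡t) (subst (suc (toℕ s) ≤_) e ≤-refl))
      where
      s≡t : s ≡ t
      s≡t = trans (sym (inverseˡ π)) (trans (cong (π ⟨$⟩ˡ_) (toℕ-injective eq)) (inverseˡ π))

    increasing-before-d′ : ∀ m (s : Fin n) (ml : m < n) → toℕ s < m → m < d → πr s < πr (fromℕ< ml)
    increasing-before-d′ zero s ml () md
    increasing-before-d′ (suc m) s ml sl md with toℕ s ≟ m
    ... | yes eq = ascent-before-d s (fromℕ< ml) (trans (cong suc eq) (sym (toℕ-fromℕ< ml))) (subst (_< d) (sym (toℕ-fromℕ< ml)) md)
    ... | no ne = <-trans (increasing-before-d′ m s (<-trans (n<1+n m) ml) (≤∧≢⇒< (s≤s⁻¹ sl) ne) (<-trans (n<1+n m) md))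
                          (ascent-before-d (fromℕ< (<-trans (n<1+n m) ml)) (fromℕ< ml)
                               (trans (cong suc (toℕ-fromℕ< (<-trans (n<1+n m) ml))) (sym (toℕ-fromℕ< ml)))
                               (subst (_< d) (sym (toℕ-fromℕ< ml)) md))

    increasing-before-d : ∀ (s t : Fin n) → toℕ s < toℕ t → toℕ t < d → πr s < πr t
    increasing-before-d s t lt td = subst (λ t′ → πr s < πr t′) (fromℕ<-toℕ t (toℕ<n t)) (increasing-before-d′ (toℕ t) s (toℕ<n t) lt td)

  first-route : ∀ {x z r} → B₀.Fwd x z → B₀.Final z r → Σ Out λ o → routeAt G₀ x ≡ just o
  first-route B₀.[] (B₀.fin e _) = _ , e
  first-route (B₀.stN e B₀.∷ _) _ = _ , e
  first-route (B₀.stE e _ B₀.∷ _) _ = _ , e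

  exits⇒label<N : ∀ {u r} → B₀.Exits u r → u < N
  exits⇒label<N {u} (z , p , fz) with u <? N
  ... | yes l = l
  ... | no nl with first-route (B₀.toFwd p) fz
  ...   | o , e rewrite emb-hor (<-≤-trans (m<n⇒pred[n]<n nN) (≮⇒≥ nl)) (≤-trans (<⇒≤ nN) (≮⇒≥ nl)) with e
  ...     | ()

  exit-row-small : ∀ {c r} → (cn : c < n) → B₀.Exits c r → r ≡ toℕ (π ⟨$⟩ˡ fromℕ< cn)
  exit-row-small {c} cn cp = B₀.exits-unique cp (exits-small c cn)

  exit-row-large : ∀ {c r} → n ≤ c → c < N → B₀.Exits c r → r ≡ c
  exit-row-large {c} nc cN cp = B₀.exits-unique cp (exits-large c nc cN)

  module Start (k d : ℕ) (fd : FirstDescent π d) (kd : k ≤ d) where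
    open BeforeFirstDescent d fd
    open Invariant N G₀ k using (LabelsIncreasing; DroopInvariant; ExitsAboveK; ExitsPreserved; BumpOnlyAt)

    labels-increasing₀ : LabelsIncreasing
    labels-increasing₀ u v ru rv cu cv lt rvk with v <? n
    ... | no nv = ⊥-elim (<-irrefl refl (<-≤-trans (subst (_< n) (exit-row-large (≮⇒≥ nv) (exits⇒label<N cv) cv) (<-trans rvk (≤-<-trans kd d<n))) (≮⇒≥ nv)))
    ... | yes vn with u <? n
    ...   | no nu = ⊥-elim (<-irrefl refl (<-≤-trans (subst (_< n) (exit-row-large (≮⇒≥ nu) (exits⇒label<N cu) cu) (<-trans lt (<-trans rvk (≤-<-trans kd d<n)))) (≮⇒≥ nu)))
    ...   | yes un = subst₂ _<_ (ur un) (ur vn) (increasing-before-d (π ⟨$⟩ˡ fromℕ< un) (π ⟨$⟩ˡ fromℕ< vn) lt′ rvd)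
      where
      ur : ∀ {c} (cn : c < n) → πr (π ⟨$⟩ˡ fromℕ< cn) ≡ c
      ur cn = trans (cong toℕ (inverseʳ π)) (toℕ-fromℕ< cn)
      lt′ : toℕ (π ⟨$⟩ˡ fromℕ< un) < toℕ (π ⟨$⟩ˡ fromℕ< vn)
      lt′ = subst₂ _<_ (exit-row-small un cu) (exit-row-small vn cv) lt
      rvd : toℕ (π ⟨$⟩ˡ fromℕ< vn) < d
      rvd = subst (_< d) (exit-row-small vn cv) (<-≤-trans rvk kd)

    start-inv : ∀ {r₀ j} → r₀ < k → j < N → G₀ r₀ j ≡ rel → (∀ j′ → j < j′ → j′ < N → G₀ r₀ j′ ≢ rel) → DroopInvariant G₀ r₀ j
    start-inv {r₀} {j} r₀k jN hr hmax = ((λ c cN → proj₁ (exits₀ c cN) , proj₂ (exits₀ c cN) , proj₂ (exits₀ c cN)) , Crosses₀.crosses-ordered₀ k)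
                                       , (λ i j e → ⊥-elim (emb-nobump i j e)) , c₀ , kp , path
      where
      r₀n : r₀ < n
      r₀n = <-trans r₀k (≤-<-trans kd d<n)
      R = fromℕ< r₀n
      C = π ⟨$⟩ʳ R
      c₀ = toℕ C
      c₀n : c₀ < n
      c₀n = toℕ<n C
      cp : B₀.Exits c₀ r₀
      cp = subst (B₀.Exits c₀) (trans (cong (λ X → toℕ (π ⟨$⟩ˡ X)) (fromℕ<-toℕ C c₀n)) (trans (cong toℕ (inverseˡ π)) (toℕ-fromℕ< r₀n))) (exits-small c₀ c₀n)
      kp : ExitsAboveK c₀
      kp = <-trans c₀n nN , λ r cr → subst (_< k) (B₀.exits-unique cp cr) r₀k
      path : B₀.Path (src c₀) (r₀ , j , fromS)
      path with cp
      ... | (.r₀ , jf , df) , pf , B₀.fin e nl with RowEntry.row-entry N G₀ pf e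
      ...   | j″ , le , ps , es , all with <-cmp j″ j
      ...     | tri≈ _ refl _ = ps
      ...     | tri< l _ _ with onroute₀ (<-trans c₀n nN) (all j l (s≤s⁻¹ (≤-trans jN (≮⇒≥ nl))))
      ...       | o , eo rewrite hr with eo
      ...         | ()
      path | (.r₀ , jf , df) , pf , B₀.fin e nl | j″ , le , ps , es , all | tri> _ _ l with route-SE⇒rel⊎bump es
      ... | inj₂ b = ⊥-elim (emb-nobump r₀ j″ b)
      ... | inj₁ rl = ⊥-elim (hmax j″ l (≤-<-trans le (Go₀.path-colN (<-trans c₀n nN) pf)) rl)

    open InsertionSteps N G₀ k labels-increasing₀

    reach-invariant : ∀ {r₀ G a c} → r₀ < k → Reach N G₀ r₀ k G a c → DroopInvariant G a c
    reach-invariant r₀<k (start _ jN hr hmax) = start-inv r₀<k jN hr hmax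
    reach-invariant r₀<k (stepJ r md hj lt hr hmax) = stepJ-inv (reach-invariant r₀<k r) md hj lt hr hmax
    reach-invariant r₀<k (stepSwap r md hb v1 v2 hz vc1 vc2) = stepSwap-inv (reach-invariant r₀<k r) md hb v1 v2 hz vc1 vc2
    reach-invariant r₀<k (stepBump r md hb _ vc er rk) = stepBump-inv (reach-invariant r₀<k r) md hb vc er rk

lemma5p2 : (n : ℕ) (π : Permutation′ n) (D : Grid) → IsBPD n π D →
    ¬ (∀ i → π ⟨$⟩ʳ i ≡ i) →
    (d : ℕ) → FirstDescent π d →
    (b k : ℕ) → 1 ≤ b → b ≤ k → k ≤ d →
    (N : ℕ) → n < N →
    ∀ G a₀ b₀ → Reach N (embed n D) (b ∸ 1) k G a₀ b₀ →
    ∀ x y G′ → MinDroop N G a₀ b₀ x y G′ →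
    (∀ c → Visits N G c (a₀ , b₀ , fromS) →
    ∀ i j → G i j ≡ cross → ¬ Visits N G c (i , j , fromW)) ×
    y ≡ 1
lemma5p2 n π D bpd _ d fd b k 1≤b b≤k k≤d N nN G a₀ b₀ rch x y G′ md =
  droop-pipe-never-horizontal inv , droop-width-one inv md
  where
  open Initial n N π D bpd nN
  open Start k d fd k≤d
  open InsertionSteps N (embed n D) k labels-increasing₀
  open Invariant N (embed n D) k using (DroopInvariant)
  inv : DroopInvariant G a₀ b₀
  inv = reach-invariant (<-≤-trans (m<n⇒pred[n]<n 1≤b) b≤k) rch
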